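{- BASES $\leq$ CIRCUITS; that is, there is a Turing machine running in time polynomial in its input length which, for every matroid $M$, given the list of all bases of $M$ outputs the list of all circuits of $M$.
   Context: All matroids are finite. A matroid is described to a Turing machine by a list of subsets of its ground set $E$ ($|E| = n$), each subset encoded by its characteristic vector, with a reasonable encoding (no padding), so a description listing $i$ subsets has length $\Theta(ni)$. For two description types $I_1, I_2$, $I_1 \leq I_2$ means there is a polynomial-time Turing machine producing the $I_2$-description of $M$ from the $I_1$-description of $M$, for every matroid $M$. -}

module Defs where

open import Data.Nat using (ℕ; zero; suc; _+_; _*_; _^_; _≤_)
open import Data.Fin using (Fin; zero; suc)
open import Data.Fin.Subset using (Subset; _∈_; _∉_; _⊂_; _⊆_; _∪_; _-_; ⁅_⁆)
open import Data.Bool using (Bool; true; false)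
open import Data.List using (List; []; _∷_; _++_; length; concatMap; map)
open import Data.List.Relation.Unary.Unique.Propositional using (Unique)
import Data.List.Membership.Propositional as L
open import Data.Vec using (toList)
open import Data.Maybe using (Maybe; just; nothing)
open import Data.Product using (Σ; ∃; ∃-syntax; _×_; _,_)
open import Relation.Nullary using (¬_)
open import Relation.Binary.PropositionalEquality using (_≡_)
open import Function.Bundles using (_⇔_)

record Matroid (n : ℕ) : Set₁ where
  field
    IsBase        : Subset n → Set
    base-nonempty : ∃[ B ] IsBase B
    base-exchange : ∀ {B₁ B₂ x} → IsBase B₁ → IsBase B₂ → x ∈ B₁ → x ∉ B₂ →
                    ∃[ y ] (y ∈ B₂ × y ∉ B₁ × IsBase ((B₁ - x) ∪ ⁅ y ⁆))

module _ {n : ℕ} (M : Matroid n) where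
  open Matroid M

  Independent : Subset n → Set
  Independent X = ∃[ B ] (IsBase B × X ⊆ B)

  Dependent : Subset n → Set
  Dependent X = ¬ Independent X

  IsCircuit : Subset n → Set
  IsCircuit C = Dependent C × (∀ D → D ⊂ C → Independent D)

Enumerates : {n : ℕ} → (Subset n → Set) → List (Subset n) → Set
Enumerates P xs = Unique xs × (∀ X → (X L.∈ xs) ⇔ P X)

-- tape symbols: 0 = blank, 1 = '0', 2 = '1', 3 = '#', further symbols extra
Sym : ℕ → Set
Sym e = Fin (4 + e)

blank : ∀ {e} → Sym e
blank = zero

bitSym : ∀ {e} → Bool → Sym e
bitSym false = suc zero
bitSym true  = suc (suc zero)

sepSym : ∀ {e} → Sym e
sepSym = suc (suc (suc zero))

data Move : Set where
  left right stay : Move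

record TM : Set where
  field
    extra   : ℕ
    nStates : ℕ
    start   : Fin nStates
    -- nothing = halt
    δ       : Fin nStates → Sym extra → Maybe (Fin nStates × Sym extra × Move)

module _ (T : TM) where
  open TM T

  -- configuration: state, reversed cells left of head, head cell, cells right of head
  record Config : Set where
    constructor cfg
    field
      state : Fin nStates
      lft   : List (Sym extra)
      cur   : Sym extra
      rgt   : List (Sym extra)

  move : Move → List (Sym extra) → Sym extra → List (Sym extra) →
         List (Sym extra) × Sym extra × List (Sym extra)
  move left  []       c r = [] , blank , c ∷ r
  move left  (a ∷ l)  c r = l , a , c ∷ r
  move right l c []       = c ∷ l , blank , []
  move right l c (a ∷ r)  = c ∷ l , a , r
  move stay  l c r        = l , c , r

  step : Config → Maybe Config
  step (cfg q l c r) with δ q c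
  ... | nothing = nothing
  ... | just (q' , s , m) with move m l s r
  ...   | l' , c' , r' = just (cfg q' l' c' r')

  Halted : Config → Set
  Halted c = step c ≡ nothing

  run : ℕ → Config → Config
  run zero    c = c
  run (suc k) c with step c
  ... | nothing = c
  ... | just c' = run k c'

  initial : List (Sym extra) → Config
  initial []      = cfg start [] blank []
  initial (a ∷ w) = cfg start [] a w

  -- output: the maximal blank-free word starting at the head cell
  takeNonBlank : List (Sym extra) → List (Sym extra)
  takeNonBlank []       = []
  takeNonBlank (zero ∷ w) = []
  takeNonBlank (suc a ∷ w) = suc a ∷ takeNonBlank w

  output : Config → List (Sym extra)
  output (cfg q l c r) = takeNonBlank (c ∷ r)

  HaltsWithin : ℕ → List (Sym extra) → List (Sym extra) → Set
  HaltsWithin t w v = ∃[ k ] (k ≤ t × Halted (run k (initial w)) × output (run k (initial w)) ≡ v)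

-- Encoding of a list of subsets: characteristic vectors, each followed by '#'

encodeSet : ∀ {e n} → Subset n → List (Sym e)
encodeSet X = map bitSym (toList X) ++ (sepSym ∷ [])

encodeSets : ∀ {e n} → List (Subset n) → List (Sym e)
encodeSets = concatMap encodeSet

{-# OPTIONS --safe #-}
-- Every circuit is a fundamental circuit: if B is a basis and e ∉ B, then
-- C(B, e) = {e} ∪ {f ∈ B | B - f + e is a basis} is a circuit, and a circuit C equals C(B, e)
-- whenever C ─ B = {e}; such a basis exists because C - e is independent. The machine runs
-- through the pairs (Bᵢ, e) of a listed basis and an element e ∉ Bᵢ, computes C(Bᵢ, e) by
-- comparing Bᵢ - f + e with every listed basis, and prints it only if i is the least index with
-- |C ─ Bᵢ| ≤ 1, so that every circuit is printed exactly once. It is compiled from a program of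
-- sweeps of finite-state transducers over the tape; with m bases there are O(m n) candidates of
-- O(n) sweeps each, over a tape of length O(m n), so for input length L = m (n + 1) the run
-- takes at most 100 L⁴ + 100 steps.
module Submission where

open import Defs
open import Data.Nat using (ℕ; zero; suc; _+_; _*_; _^_; _≡ᵇ_; _<_; _≤_; s≤s; z≤n)
open import Data.Bool using (Bool; true; false; _∧_; _∨_; not; if_then_else_)
open import Data.List using (List; []; _∷_; _++_; length; map)
open import Data.List.Membership.Propositional.Properties using (∉[])
open import Data.Vec using (Vec; []; _∷_)
open import Data.Fin.Subset using (Subset)
open import Data.Product using (∃; ∃-syntax; _×_; _,_; proj₂)
open import Data.Empty using (⊥-elim)
open import Function.Bundles using (Equivalence)

module FundamentalCircuit where

  open import Data.Nat using (ℕ)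
  open import Data.Fin using (Fin)
  open import Data.Fin.Properties using (any?) renaming (_≟_ to _≟ᶠ_)
  open import Data.Fin.Subset using (Subset; _∈_; _∉_; _⊆_; _⊂_; _∪_; _─_; _-_; ⁅_⁆; inside; outside)
  open import Data.Fin.Subset.Properties
    using (x∈p∪q⁺; x∈p∪q⁻; x∈⁅x⁆; x∈⁅y⁆⇒x≡y; x∈p∧x≢y⇒x∈p-y; p─q⊆p; x∈p∧x∉q⇒x∈p─q; ⊆-antisym; _∈?_)
  open import Data.Fin.Subset.Induction using (⊂-wellFounded)
  open import Induction.WellFounded using (Acc; acc)
  open import Data.Vec using (_∷_; here; there)
  open import Data.Product using (_×_; _,_)
  open import Data.Sum using (_⊎_; inj₁; inj₂)
  open import Data.Empty using (⊥; ⊥-elim)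
  open import Function.Base using (_∘_)
  open import Function.Bundles using (_⇔_; Equivalence)
  open import Relation.Nullary using (yes; no)
  open import Relation.Binary.PropositionalEquality using (_≡_; _≢_; refl; sym; trans; subst)
  open import Defs using (Matroid; Independent; Dependent; IsCircuit)
  open Equivalence using (to; from)

  x∈p─q⇒x∉q : ∀ {n} (p q : Subset n) {x} → x ∈ p ─ q → x ∉ q
  x∈p─q⇒x∉q (_ ∷ p) (inside ∷ q) (there x∈p─q) (there x∈q) = x∈p─q⇒x∉q p q x∈p─q x∈q
  x∈p─q⇒x∉q (inside ∷ p) (outside ∷ q) here ()
  x∈p─q⇒x∉q (_ ∷ p) (outside ∷ q) (there x∈p─q) (there x∈q) = x∈p─q⇒x∉q p q x∈p─q x∈q

  x∉p∧x∉q⇒x∉p∪q : ∀ {n} {p q : Subset n} {x} → x ∉ p → x ∉ q → x ∉ p ∪ q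
  x∉p∧x∉q⇒x∉p∪q {p = p} {q} x∉p x∉q x∈p∪q with x∈p∪q⁻ p q x∈p∪q
  ... | inj₁ x∈p = x∉p x∈p
  ... | inj₂ x∈q = x∉q x∈q

  exchange : ∀ {n} → Subset n → Fin n → Fin n → Subset n
  exchange B x y = (B - x) ∪ ⁅ y ⁆

  module _ {n : ℕ} {B : Subset n} {x y : Fin n} where

    ∈-exchange : ∀ {z} → z ∈ B → z ≢ x → z ∈ exchange B x y
    ∈-exchange z∈B z≢x = x∈p∪q⁺ (inj₁ (x∈p∧x≢y⇒x∈p-y z∈B z≢x))

    new∈exchange : y ∈ exchange B x y
    new∈exchange = x∈p∪q⁺ (inj₂ (x∈⁅x⁆ y))

    ∈-exchange⁻ : ∀ {z} → z ∈ exchange B x y → (z ∈ B × z ≢ x) ⊎ z ≡ y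
    ∈-exchange⁻ z∈ with x∈p∪q⁻ (B - x) ⁅ y ⁆ z∈
    ... | inj₁ z∈B-x = inj₁ (p─q⊆p B ⁅ x ⁆ z∈B-x , λ z≡x → x∈p─q⇒x∉q B ⁅ x ⁆ z∈B-x (subst (_∈ ⁅ x ⁆) (sym z≡x) (x∈⁅x⁆ x)))
    ... | inj₂ z∈⁅y⁆ = inj₂ (x∈⁅y⁆⇒x≡y y z∈⁅y⁆)

  module _ {n : ℕ} (M : Matroid n) where
    open Matroid M

    InFundamental : Subset n → Fin n → Fin n → Set
    InFundamental B e x = x ≡ e ⊎ (x ∈ B × IsBase (exchange B x e))

    IsFundamentalCircuit : Subset n → Fin n → Subset n → Set
    IsFundamentalCircuit B e D = ∀ x → x ∈ D ⇔ InFundamental B e x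

    -- A basis B' ⊇ D is pushed towards B by exchanges (which keep D ⊆ B', as D ⊆ B ∪ ⁅ e ⁆),
    -- decreasing B' ─ (B ∪ ⁅ e ⁆); once that is empty, a double exchange puts some y ∈ D into B ─ B'.
    fundamental-dependent : ∀ {B e D} → IsBase B → e ∉ B → IsFundamentalCircuit B e D → Dependent M D
    fundamental-dependent {B} {e} {D} B-base e∉B D-fund (B' , B'-base , D⊆B') =
      descend B' (⊂-wellFounded (outside-B∪e B')) B'-base D⊆B'
      where
      outside-B∪e : Subset n → Subset n
      outside-B∪e X = X ─ (B ∪ ⁅ e ⁆)

      D⊆B∪e : D ⊆ B ∪ ⁅ e ⁆
      D⊆B∪e {z} z∈D with to (D-fund z) z∈D
      ... | inj₁ z≡e = x∈p∪q⁺ (inj₂ (subst (_∈ ⁅ e ⁆) (sym z≡e) (x∈⁅x⁆ e)))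
      ... | inj₂ (z∈B , _) = x∈p∪q⁺ (inj₁ z∈B)

      descend : ∀ B' → Acc _⊂_ (outside-B∪e B') → IsBase B' → D ⊆ B' → ⊥
      descend B' (acc smaller) B'-base D⊆B' with any? (λ g → g ∈? outside-B∪e B')
      ... | yes (g , g∈out) with base-exchange B'-base B-base (p─q⊆p B' _ g∈out) g∉B
        where
        g∉B : g ∉ B
        g∉B g∈B = x∈p─q⇒x∉q B' _ g∈out (x∈p∪q⁺ (inj₁ g∈B))
      ...   | y , y∈B , y∉B' , B''-base = descend (exchange B' g y) (smaller shrinks) B''-base D⊆B''
        where
        g∉B∪e : g ∉ B ∪ ⁅ e ⁆
        g∉B∪e = x∈p─q⇒x∉q B' _ g∈out
        D⊆B'' : D ⊆ exchange B' g y
        D⊆B'' {z} z∈D = ∈-exchange (D⊆B' z∈D) λ z≡g → g∉B∪e (subst (_∈ B ∪ ⁅ e ⁆) z≡g (D⊆B∪e z∈D))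
        g∉B'' : g ∉ exchange B' g y
        g∉B'' g∈B'' with ∈-exchange⁻ g∈B''
        ... | inj₁ (_ , g≢g) = g≢g refl
        ... | inj₂ g≡y = y∉B' (subst (_∈ B') g≡y (p─q⊆p B' _ g∈out))
        out''⊆out : outside-B∪e (exchange B' g y) ⊆ outside-B∪e B'
        out''⊆out {z} z∈out with ∈-exchange⁻ (p─q⊆p _ _ z∈out)
        ... | inj₁ (z∈B' , _) = x∈p∧x∉q⇒x∈p─q z∈B' (x∈p─q⇒x∉q _ _ z∈out)
        ... | inj₂ z≡y = ⊥-elim (x∈p─q⇒x∉q _ _ z∈out (x∈p∪q⁺ (inj₁ (subst (_∈ B) (sym z≡y) y∈B))))
        shrinks : outside-B∪e (exchange B' g y) ⊂ outside-B∪e B'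
        shrinks = out''⊆out , g , g∈out , λ g∈out'' → g∉B'' (p─q⊆p _ _ g∈out'')
      descend B' (acc smaller) B'-base D⊆B' | no nothing-outside
        with base-exchange B'-base B-base (D⊆B' (from (D-fund e) (inj₁ refl))) e∉B
      ... | y , y∈B , y∉B' , _ with base-exchange B-base B'-base y∈B y∉B'
      ...   | z , z∈B' , z∉B , B-y+z-base with z ≟ᶠ e
      ...     | yes z≡e = y∉B' (D⊆B' (from (D-fund y) (inj₂ (y∈B , subst (IsBase ∘ exchange B y) z≡e B-y+z-base))))
      ...     | no z≢e = nothing-outside (z , x∈p∧x∉q⇒x∈p─q z∈B' (x∉p∧x∉q⇒x∉p∪q z∉B (z≢e ∘ x∈⁅y⁆⇒x≡y e)))

    fundamental-minimal : ∀ {B e D} → IsBase B → IsFundamentalCircuit B e D → ∀ D' → D' ⊂ D → Independent M D'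
    fundamental-minimal {B} {e} {D} B-base D-fund D' (D'⊆D , x , x∈D , x∉D') with to (D-fund x) x∈D
    ... | inj₁ x≡e = B , B-base , λ {z} z∈D' → in-B z z∈D' (to (D-fund z) (D'⊆D z∈D'))
      where
      in-B : ∀ z → z ∈ D' → InFundamental B e z → z ∈ B
      in-B z z∈D' (inj₁ z≡e) = ⊥-elim (x∉D' (subst (_∈ D') (trans z≡e (sym x≡e)) z∈D'))
      in-B z z∈D' (inj₂ (z∈B , _)) = z∈B
    ... | inj₂ (x∈B , exchange-base) = exchange B x e , exchange-base , λ {z} z∈D' → in-exchange z z∈D' (to (D-fund z) (D'⊆D z∈D'))
      where
      in-exchange : ∀ z → z ∈ D' → InFundamental B e z → z ∈ exchange B x e
      in-exchange z z∈D' (inj₁ z≡e) = subst (_∈ exchange B x e) (sym z≡e) new∈exchange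
      in-exchange z z∈D' (inj₂ (z∈B , _)) = ∈-exchange z∈B (λ z≡x → x∉D' (subst (_∈ D') z≡x z∈D'))

    fundamental-isCircuit : ∀ {B e D} → IsBase B → e ∉ B → IsFundamentalCircuit B e D → IsCircuit M D
    fundamental-isCircuit B-base e∉B D-fund = fundamental-dependent B-base e∉B D-fund , fundamental-minimal B-base D-fund

    circuit≡fundamental : ∀ {B e C D} → IsCircuit M C → e ∈ C → IsBase B → (∀ {x} → x ∈ C → x ≢ e → x ∈ B) →
                          IsFundamentalCircuit B e D → C ≡ D
    circuit≡fundamental {B} {e} {C} {D} (C-dep , C-min) e∈C B-base C-e⊆B D-fund = ⊆-antisym C⊆D D⊆C
      where
      e∉B : e ∉ B
      e∉B e∈B = C-dep (B , B-base , λ {x} x∈C → C⊆B x x∈C)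
        where
        C⊆B : ∀ x → x ∈ C → x ∈ B
        C⊆B x x∈C with x ≟ᶠ e
        ... | yes x≡e = subst (_∈ B) (sym x≡e) e∈B
        ... | no x≢e = C-e⊆B x∈C x≢e
      D⊆C : D ⊆ C
      D⊆C {x} x∈D with to (D-fund x) x∈D
      ... | inj₁ x≡e = subst (_∈ C) (sym x≡e) e∈C
      ... | inj₂ (x∈B , exchange-base) with x ∈? C
      ...   | yes x∈C = x∈C
      ...   | no x∉C = ⊥-elim (C-dep (exchange B x e , exchange-base , λ {z} z∈C → C⊆exchange z z∈C))
        where
        C⊆exchange : ∀ z → z ∈ C → z ∈ exchange B x e
        C⊆exchange z z∈C with z ≟ᶠ e
        ... | yes z≡e = subst (_∈ exchange B x e) (sym z≡e) new∈exchange
        ... | no z≢e = ∈-exchange (C-e⊆B z∈C z≢e) (λ z≡x → x∉C (subst (_∈ C) z≡x z∈C))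
      C⊆D : C ⊆ D
      C⊆D {x} x∈C with x ∈? D
      ... | yes x∈D = x∈D
      ... | no x∉D = ⊥-elim (fundamental-dependent B-base e∉B D-fund (C-min D (D⊆C , x , x∈C , x∉D)))

module Coding where

  open import Data.Nat using (ℕ; _+_; _*_)
  open import Data.Fin using (Fin; zero; suc; join; splitAt; combine; remQuot)
  open import Data.Fin.Properties using (splitAt-join; remQuot-combine)
  open import Data.Bool using (Bool; true; false)
  open import Data.Sum using (_⊎_; inj₁; inj₂)
  open import Data.Product using (_×_; _,_; proj₁; proj₂)
  open import Data.Maybe using (Maybe; just; nothing)
  open import Data.Unit using (⊤; tt)
  open import Relation.Binary.PropositionalEquality using (_≡_; refl; trans; cong; cong₂)

  record FinCode (A : Set) : Set where
    field
      size          : ℕ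
      encode        : A → Fin size
      decode        : Fin size → A
      decode-encode : ∀ a → decode (encode a) ≡ a
  open FinCode public

  fin-code : ∀ {k} → FinCode (Fin k)
  fin-code {k} = record { size = k ; encode = λ i → i ; decode = λ i → i ; decode-encode = λ _ → refl }

  unit-code : FinCode ⊤
  unit-code = record { size = 1 ; encode = λ _ → zero ; decode = λ _ → tt ; decode-encode = λ _ → refl }

  retract-code : ∀ {A B} → FinCode A → (f : A → B) (g : B → A) → (∀ b → f (g b) ≡ b) → FinCode B
  retract-code cA f g f∘g = record
    { size = size cA ; encode = λ b → encode cA (g b) ; decode = λ i → f (decode cA i)
    ; decode-encode = λ b → trans (cong f (decode-encode cA (g b))) (f∘g b) }

  bool-code : FinCode Bool
  bool-code = retract-code (fin-code {2}) to-bool from-bool to-from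
    where
    to-bool : Fin 2 → Bool
    to-bool zero = false
    to-bool (suc _) = true
    from-bool : Bool → Fin 2
    from-bool false = zero
    from-bool true = suc zero
    to-from : ∀ b → to-bool (from-bool b) ≡ b
    to-from false = refl
    to-from true = refl

  infixr 2 _×-code_
  infixr 1 _⊎-code_

  _⊎-code_ : ∀ {A B} → FinCode A → FinCode B → FinCode (A ⊎ B)
  _⊎-code_ {A} {B} cA cB = record { size = size cA + size cB ; encode = enc ; decode = dec ; decode-encode = dec-enc }
    where
    enc : A ⊎ B → Fin (size cA + size cB)
    enc (inj₁ a) = join (size cA) (size cB) (inj₁ (encode cA a))
    enc (inj₂ b) = join (size cA) (size cB) (inj₂ (encode cB b))
    dec : Fin (size cA + size cB) → A ⊎ B
    dec i with splitAt (size cA) i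
    ... | inj₁ x = inj₁ (decode cA x)
    ... | inj₂ y = inj₂ (decode cB y)
    dec-enc : ∀ s → dec (enc s) ≡ s
    dec-enc (inj₁ a) rewrite splitAt-join (size cA) (size cB) (inj₁ (encode cA a)) = cong inj₁ (decode-encode cA a)
    dec-enc (inj₂ b) rewrite splitAt-join (size cA) (size cB) (inj₂ (encode cB b)) = cong inj₂ (decode-encode cB b)

  _×-code_ : ∀ {A B} → FinCode A → FinCode B → FinCode (A × B)
  _×-code_ {A} {B} cA cB = record { size = size cA * size cB ; encode = enc ; decode = dec ; decode-encode = dec-enc }
    where
    enc : A × B → Fin (size cA * size cB)
    enc (a , b) = combine (encode cA a) (encode cB b)
    dec : Fin (size cA * size cB) → A × B
    dec i = decode cA (proj₁ (remQuot {size cA} (size cB) i)) , decode cB (proj₂ (remQuot {size cA} (size cB) i))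
    dec-enc : ∀ p → dec (enc p) ≡ p
    dec-enc (a , b) = trans (cong (λ p → decode cA (proj₁ p) , decode cB (proj₂ p)) (remQuot-combine {size cA} {size cB} (encode cA a) (encode cB b)))
                            (cong₂ _,_ (decode-encode cA a) (decode-encode cB b))

  maybe-code : ∀ {A} → FinCode A → FinCode (Maybe A)
  maybe-code {A} cA = retract-code (unit-code ⊎-code cA) from-sum to-sum from-to
    where
    from-sum : ⊤ ⊎ A → Maybe A
    from-sum (inj₁ _) = nothing
    from-sum (inj₂ a) = just a
    to-sum : Maybe A → ⊤ ⊎ A
    to-sum nothing = inj₁ tt
    to-sum (just a) = inj₂ a
    from-to : ∀ m → from-sum (to-sum m) ≡ m
    from-to nothing = refl
    from-to (just a) = refl

module SweepMachine (A : Set) (A-code : Coding.FinCode A) where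

  open Coding

  open import Data.Nat using (ℕ; zero; suc; _+_; _*_; _≤_)
  open import Data.Nat.Tactic.RingSolver using (solve-∀)
  open import Data.Fin using (Fin; zero; suc)
  open import Data.Bool using (Bool; true; false)
  open import Data.Sum using (inj₁; inj₂)
  open import Data.Product using (∃; ∃-syntax; _×_; _,_; proj₁; proj₂)
  open import Data.Maybe using (Maybe; just; nothing)
  open import Data.Unit using (⊤)
  open import Data.List using (List; []; _∷_; _++_; length; map; concatMap; reverse; _ʳ++_)
  open import Data.List.Properties using (reverse-map; ++-assoc; ʳ++-defn; ʳ++-ʳ++; length-reverse; length-++; map-++)
  open import Data.Vec using (Vec; []; _∷_; toList)
  open import Data.List.Relation.Unary.All using (All; []; _∷_)
  open import Relation.Binary.PropositionalEquality
  open ≡-Reasoning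

  data Cell : Set where
    raw : Maybe Bool → Cell
    trk : A → Cell

  Sy : Set
  Sy = Sym (size A-code)

  encCell : Cell → Sy
  encCell (raw (just b)) = bitSym b
  encCell (raw nothing) = sepSym
  encCell (trk t) = suc (suc (suc (suc (encode A-code t))))

  encs : List Cell → List Sy
  encs = map encCell

  data View : Set where
    empty : View
    filled : Cell → View

  encView : View → Sy
  encView empty = blank
  encView (filled x) = encCell x

  decodeSym : Sy → View
  decodeSym zero = empty
  decodeSym (suc zero) = filled (raw (just false))
  decodeSym (suc (suc zero)) = filled (raw (just true))
  decodeSym (suc (suc (suc zero))) = filled (raw nothing)
  decodeSym (suc (suc (suc (suc t)))) = filled (trk (decode A-code t))

  decodeSym-encView : ∀ v → decodeSym (encView v) ≡ v
  decodeSym-encView empty = refl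
  decodeSym-encView (filled (raw (just false))) = refl
  decodeSym-encView (filled (raw (just true))) = refl
  decodeSym-encView (filled (raw nothing)) = refl
  decodeSym-encView (filled (trk t)) = cong (filled ∘′ trk) (decode-encode A-code t)
    where open import Function.Base using (_∘′_)

  hd : List Sy → Sy
  hd [] = blank
  hd (x ∷ _) = x

  tl : List Sy → List Sy
  tl [] = []
  tl (_ ∷ r) = r

  Blank : List Sy → Set
  Blank = All (_≡ blank)

  hd-Blank : ∀ {bs} → Blank bs → hd bs ≡ blank
  hd-Blank [] = refl
  hd-Blank (b≡blank ∷ _) = b≡blank

  tl-Blank : ∀ {bs} → Blank bs → Blank (tl bs)
  tl-Blank [] = []
  tl-Blank (_ ∷ bs-blank) = bs-blank

  setBits : ∀ {l} → Vec Bool l → List (Maybe Bool)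
  setBits V = map just (toList V) ++ nothing ∷ []

  setsBits : ∀ {l} → List (Vec Bool l) → List (Maybe Bool)
  setsBits = concatMap setBits

  encs-setBits : ∀ {l} (V : Vec Bool l) → encs (map raw (setBits V)) ≡ encodeSet V
  encs-setBits [] = refl
  encs-setBits (b ∷ V) = cong (bitSym b ∷_) (encs-setBits V)

  encs-setsBits : ∀ {l} (Vs : List (Vec Bool l)) → encs (map raw (setsBits Vs)) ≡ encodeSets Vs
  encs-setsBits [] = refl
  encs-setsBits (V ∷ Vs) = begin
    encs (map raw (setBits V ++ setsBits Vs))                      ≡⟨ cong encs (map-++ raw (setBits V) (setsBits Vs)) ⟩
    encs (map raw (setBits V) ++ map raw (setsBits Vs))            ≡⟨ map-++ encCell (map raw (setBits V)) _ ⟩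
    encs (map raw (setBits V)) ++ encs (map raw (setsBits Vs))     ≡⟨ cong₂ _++_ (encs-setBits V) (encs-setsBits Vs) ⟩
    encodeSet V ++ encodeSets Vs                                   ∎

  length-setsBits : ∀ {l} (Vs : List (Vec Bool l)) → length (setsBits Vs) ≡ length Vs * suc l
  length-setsBits {l} [] = refl
  length-setsBits {l} (V ∷ Vs) = begin
    length (setBits V ++ setsBits Vs)         ≡⟨ length-++ (setBits V) ⟩
    length (setBits V) + length (setsBits Vs) ≡⟨ cong₂ _+_ (length-setBits V) (length-setsBits Vs) ⟩
    suc l + length Vs * suc l                 ∎
    where
    length-setBits : ∀ {k} (V : Vec Bool k) → length (setBits V) ≡ suc k
    length-setBits [] = refl
    length-setBits (_ ∷ V) = cong suc (length-setBits V)

  Transducer : Set → Set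
  Transducer Q = Q → Cell → Q × Cell

  transduce : ∀ {Q} → Transducer Q → Q → List Cell → Q × List Cell
  transduce τ q [] = q , []
  transduce τ q (x ∷ xs) = proj₁ (transduce τ (proj₁ (τ q x)) xs) , proj₂ (τ q x) ∷ proj₂ (transduce τ (proj₁ (τ q x)) xs)

  length-transduce : ∀ {Q} (τ : Transducer Q) q xs → length (proj₂ (transduce τ q xs)) ≡ length xs
  length-transduce τ q [] = refl
  length-transduce τ q (x ∷ xs) = cong suc (length-transduce τ _ xs)

  appended : Maybe (Maybe Bool) → List Cell
  appended nothing = []
  appended (just r) = raw r ∷ []

  -- In phase c the machine sweeps the transducer τ c over the tape from the left end, writes the
  -- cell append c q (if any) after the last cell, q being the final transducer state, returns to
  -- the left end and starts phase next c q; when there is none, it moves right past the tracked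
  -- cells and halts on the first raw cell.
  module Compile (Phase : Set) (phase-code : FinCode Phase) (Q : Set) (Q-code : FinCode Q)
                 (q₀ : Phase → Q) (τ : Phase → Transducer Q)
                 (append : Phase → Q → Maybe (Maybe Bool)) (next : Phase → Q → Maybe Phase) (start : Phase) where

    data Control : Set where
      sweeping  : Phase → Q → Control
      returning : Maybe Phase → Control
      seeking   : Control

    control-code : FinCode Control
    control-code = retract-code ((phase-code ×-code Q-code) ⊎-code maybe-code phase-code ⊎-code unit-code) from-sum to-sum from-to
      where
      from-sum : (Phase × Q) Data.Sum.⊎ (Maybe Phase Data.Sum.⊎ ⊤) → Control
      from-sum (inj₁ (c , q)) = sweeping c q
      from-sum (inj₂ (inj₁ m)) = returning m
      from-sum (inj₂ (inj₂ _)) = seeking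
      to-sum : Control → (Phase × Q) Data.Sum.⊎ (Maybe Phase Data.Sum.⊎ ⊤)
      to-sum (sweeping c q) = inj₁ (c , q)
      to-sum (returning m) = inj₂ (inj₁ m)
      to-sum seeking = inj₂ (inj₂ _)
      from-to : ∀ s → from-sum (to-sum s) ≡ s
      from-to (sweeping c q) = refl
      from-to (returning m) = refl
      from-to seeking = refl

    entering : Phase → Control
    entering c = sweeping c (q₀ c)

    resume : Maybe Phase → Control
    resume (just c) = entering c
    resume nothing = seeking

    written : Maybe (Maybe Bool) → View
    written nothing = empty
    written (just r) = filled (raw r)

    transition : Control → View → Maybe (Control × View × Move)
    transition (sweeping c q) (filled x) = just (sweeping c (proj₁ (τ c q x)) , filled (proj₂ (τ c q x)) , right)
    transition (sweeping c q) empty = just (returning (next c q) , written (append c q) , left)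
    transition (returning m) (filled x) = just (returning m , filled x , left)
    transition (returning m) empty = just (resume m , empty , right)
    transition seeking (filled (trk t)) = just (seeking , filled (trk t) , right)
    transition seeking (filled (raw _)) = nothing
    transition seeking empty = nothing

    encodeAction : Maybe (Control × View × Move) → Maybe (Fin (size control-code) × Sy × Move)
    encodeAction nothing = nothing
    encodeAction (just (s , v , m)) = just (encode control-code s , encView v , m)

    machine : TM
    machine = record
      { extra = size A-code ; nStates = size control-code ; start = encode control-code (entering start)
      ; δ = λ s x → encodeAction (transition (decode control-code s) (decodeSym x)) }

    Conf : Set
    Conf = Config machine

    -- conf: the head is on the first cell of r; confˡ: the head is on the first cell of l.
    conf : Control → List Sy → List Sy → Conf
    conf st l r = cfg (encode control-code st) l (hd r) (tl r)

    confˡ : Control → List Sy → List Sy → Conf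
    confˡ st l r = cfg (encode control-code st) (tl l) (hd l) r

    δ-encode : ∀ st v → TM.δ machine (encode control-code st) (encView v) ≡ encodeAction (transition st v)
    δ-encode st v rewrite decode-encode control-code st | decodeSym-encView v = refl

    place : Control → List Sy × Sy × List Sy → Conf
    place st (l , c , r) = cfg (encode control-code st) l c r

    step-transition : ∀ {st v st' v' mv} l r → transition st v ≡ just (st' , v' , mv) →
                      step machine (cfg (encode control-code st) l (encView v) r) ≡ just (place st' (move machine mv l (encView v') r))
    step-transition {st} {v} l r eq with TM.δ machine (encode control-code st) (encView v) | δ-encode st v
    ... | _ | refl rewrite eq = refl

    step-halt : ∀ st v l r → transition st v ≡ nothing → Halted machine (cfg (encode control-code st) l (encView v) r)
    step-halt st v l r eq with TM.δ machine (encode control-code st) (encView v) | δ-encode st v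
    ... | _ | refl rewrite eq = refl

    step-right : ∀ st v {st' v'} l r → transition st v ≡ just (st' , v' , right) →
                 step machine (conf st l (encView v ∷ r)) ≡ just (conf st' (encView v' ∷ l) r)
    step-right st v l [] eq = step-transition l [] eq
    step-right st v l (_ ∷ _) eq = step-transition l _ eq

    step-left : ∀ st v {st' v'} l r → transition st v ≡ just (st' , v' , left) →
                step machine (cfg (encode control-code st) l (encView v) r) ≡ just (confˡ st' l (encView v' ∷ r))
    step-left st v [] r eq = step-transition [] r eq
    step-left st v (_ ∷ _) r eq = step-transition _ r eq

    data Steps : ℕ → Conf → Conf → Set where
      done : ∀ {a} → Steps 0 a a
      next-step : ∀ {k a b c} → step machine a ≡ just b → Steps k b c → Steps (suc k) a c

    infixr 5 _▷_

    _▷_ : ∀ {k l a b c} → Steps k a b → Steps l b c → Steps (k + l) a c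
    done ▷ t = t
    next-step s ss ▷ t = next-step s (ss ▷ t)

    Steps-cost : ∀ {k k' a b} → k ≡ k' → Steps k a b → Steps k' a b
    Steps-cost refl s = s

    run-Steps : ∀ {k a b} → Steps k a b → run machine k a ≡ b
    run-Steps done = refl
    run-Steps (next-step {a = a} s ss) with step machine a | s
    ... | _ | refl = run-Steps ss

    halts-within : ∀ {k t w c v} → k ≤ t → Steps k (initial machine w) c → Halted machine c → output machine c ≡ v →
                   HaltsWithin machine t w v
    halts-within k≤t steps halted output≡ =
      _ , k≤t , subst (Halted machine) (sym (run-Steps steps)) halted , trans (cong (output machine) (run-Steps steps)) output≡

    sweep-right : ∀ c q u l r →
                  Steps (length u) (conf (sweeping c q) l (encs u ++ r))
                        (conf (sweeping c (proj₁ (transduce (τ c) q u))) (encs (proj₂ (transduce (τ c) q u)) ʳ++ l) r)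
    sweep-right c q [] l r = done
    sweep-right c q (x ∷ u) l r = next-step (step-right (sweeping c q) (filled x) l (encs u ++ r) refl) (sweep-right c (proj₁ (τ c q x)) u _ r)

    sweep-left : ∀ m v ls R → Blank ls →
                 Steps (suc (length v)) (confˡ (returning m) (encs v ++ ls) R) (conf (resume m) (blank ∷ tl ls) (encs v ʳ++ R))
    sweep-left m [] ls R ls-blank rewrite hd-Blank ls-blank = next-step (step-right (returning m) empty (tl ls) R refl) done
    sweep-left m (x ∷ v) ls R ls-blank =
      next-step (step-left (returning m) (filled x) (encs v ++ ls) R refl) (sweep-left m v ls (encCell x ∷ R) ls-blank)

    pass-state : Phase → List Cell → Q
    pass-state c u = proj₁ (transduce (τ c) (q₀ c) u)

    pass-cells : Phase → List Cell → List Cell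
    pass-cells c u = proj₂ (transduce (τ c) (q₀ c) u)

    pass-output : Phase → List Cell → List Cell
    pass-output c u = pass-cells c u ++ appended (append c (pass-state c u))

    pass-next : Phase → List Cell → Maybe Phase
    pass-next c u = next c (pass-state c u)

    Loaded : Conf → Control → List Cell → Set
    Loaded a st u = ∃[ ls ] ∃[ bs ] (Blank ls × Blank bs × a ≡ conf st ls (encs u ++ bs))

    written-tape : ∀ w bs → Blank bs → ∃[ bs' ] (Blank bs' × encView (written w) ∷ bs ≡ encs (appended w) ++ bs')
    written-tape nothing bs bs-blank = blank ∷ bs , refl ∷ bs-blank , refl
    written-tape (just r) bs bs-blank = bs , bs-blank , refl

    pass-steps : ∀ c u a → Loaded a (entering c) u →
                 ∃[ b ] (Loaded b (resume (pass-next c u)) (pass-output c u) × Steps (2 * length u + 2) a b)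
    pass-steps c u _ (ls , bs , ls-blank , bs-blank , refl) with written-tape (append c q) (tl bs) (tl-Blank bs-blank)
      where q = pass-state c u
    ... | bs' , bs'-blank , tape-eq =
      conf (resume nc) (blank ∷ tl ls) (encs (reverse u₁) ʳ++ (encView (written w) ∷ tl bs)) ,
      (blank ∷ tl ls , bs' , refl ∷ tl-Blank ls-blank , bs'-blank , cong (conf (resume nc) (blank ∷ tl ls)) final-tape) ,
      Steps-cost cost (sweep-right c (q₀ c) u ls bs ▷ write ▷ sweep-left nc (reverse u₁) ls (encView (written w) ∷ tl bs) ls-blank)
      where
      q = pass-state c u
      u₁ = pass-cells c u
      nc = next c q
      w = append c q
      write : Steps 1 (conf (sweeping c q) (encs u₁ ʳ++ ls) bs)
                      (confˡ (returning nc) (encs (reverse u₁) ++ ls) (encView (written w) ∷ tl bs))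
      write rewrite hd-Blank bs-blank | ʳ++-defn (encs u₁) {ls} | reverse-map encCell u₁ =
        next-step (step-left (sweeping c q) empty _ (tl bs) refl) done
      final-tape : encs (reverse u₁) ʳ++ (encView (written w) ∷ tl bs) ≡ encs (pass-output c u) ++ bs'
      final-tape = begin
        encs (reverse u₁) ʳ++ (encView (written w) ∷ tl bs)  ≡⟨ cong (_ʳ++ (encView (written w) ∷ tl bs)) (reverse-map encCell u₁) ⟩
        reverse (encs u₁) ʳ++ (encView (written w) ∷ tl bs)  ≡⟨ ʳ++-ʳ++ (encs u₁) ⟩
        encs u₁ ++ encView (written w) ∷ tl bs               ≡⟨ cong (encs u₁ ++_) tape-eq ⟩
        encs u₁ ++ encs (appended w) ++ bs'                  ≡⟨ ++-assoc (encs u₁) _ bs' ⟨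
        (encs u₁ ++ encs (appended w)) ++ bs'                ≡⟨ cong (_++ bs') (map-++ encCell u₁ (appended w)) ⟨
        encs (pass-output c u) ++ bs'                        ∎
      cost : length u + (1 + suc (length (reverse u₁))) ≡ 2 * length u + 2
      cost rewrite length-reverse u₁ | length-transduce (τ c) (q₀ c) u = arith (length u)
        where
        arith : ∀ k → k + (1 + suc k) ≡ 2 * k + 2
        arith = solve-∀

    seek : ∀ ts l R → Steps (length ts) (conf seeking l (encs (map trk ts) ++ R)) (conf seeking (encs (map trk ts) ʳ++ l) R)
    seek [] l R = done
    seek (t ∷ ts) l R = next-step (step-right seeking (filled (trk t)) l _ refl) (seek ts _ R)

    seeking-halts : ∀ l rs bs → Blank bs → Halted machine (conf seeking l (encs (map raw rs) ++ bs))
    seeking-halts l [] bs bs-blank rewrite hd-Blank bs-blank = step-halt seeking empty l (tl bs) refl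
    seeking-halts l (r ∷ rs) bs _ = step-halt seeking (filled (raw r)) l _ refl

    takeNonBlank-raw : ∀ rs bs → Blank bs → takeNonBlank machine (encs (map raw rs) ++ bs) ≡ encs (map raw rs)
    takeNonBlank-raw [] [] _ = refl
    takeNonBlank-raw [] (_ ∷ _) (refl ∷ _) = refl
    takeNonBlank-raw (just false ∷ rs) bs bs-blank = cong (_ ∷_) (takeNonBlank-raw rs bs bs-blank)
    takeNonBlank-raw (just true ∷ rs) bs bs-blank = cong (_ ∷_) (takeNonBlank-raw rs bs bs-blank)
    takeNonBlank-raw (nothing ∷ rs) bs bs-blank = cong (_ ∷_) (takeNonBlank-raw rs bs bs-blank)

    output-raw : ∀ st l rs bs → Blank bs → output machine (conf st l (encs (map raw rs) ++ bs)) ≡ encs (map raw rs)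
    output-raw st l rs bs bs-blank = trans (output-conf (encs (map raw rs) ++ bs)) (takeNonBlank-raw rs bs bs-blank)
      where
      output-conf : ∀ R → output machine (conf st l R) ≡ takeNonBlank machine R
      output-conf [] = refl
      output-conf (_ ∷ _) = refl

    initial-conf : ∀ w → initial machine w ≡ conf (entering start) [] w
    initial-conf [] = refl
    initial-conf (_ ∷ _) = refl

module Program where

  open import Data.Fin using (Fin; #_)
  open import Data.Bool using (Bool; true; false; _∧_; _∨_; not; if_then_else_)
  open import Data.Product using (_×_; _,_; proj₁; proj₂)
  open import Data.Maybe using (Maybe; just; nothing)
  open import Data.Vec using (Vec; []; _∷_; lookup)
  open import Relation.Binary.PropositionalEquality using (_≡_; refl)
  open Coding

  -- A tracked cell stores an input bit (or a separator, as nothing) together with the marks: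
  -- inI (the cell lies in the block of the current basis Bᵢ), atE, atF, atK (the cell is in
  -- column e, f, k of its block), and the columns of the working vectors basis and circuit.
  record Track : Set where
    constructor tr
    field
      bit : Maybe Bool
      inI atE atF atK basis circuit : Bool

  track-code : FinCode Track
  track-code = retract-code (maybe-code bool-code ×-code bool-code ×-code bool-code ×-code bool-code ×-code
                             bool-code ×-code bool-code ×-code bool-code) from-tuple to-tuple from-to
    where
    from-tuple : _ → Track
    from-tuple (d , a , b , c , e , h , i) = tr d a b c e h i
    to-tuple : Track → _
    to-tuple (tr d a b c e h i) = (d , a , b , c , e , h , i)
    from-to : ∀ t → from-tuple (to-tuple t) ≡ t
    from-to (tr d a b c e h i) = refl

  open SweepMachine Track track-code public

  record Registers : Set where
    constructor regs
    field
      r₀ r₁ r₂ r₃ : Bool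

  registers-code : FinCode Registers
  registers-code = retract-code (bool-code ×-code bool-code ×-code bool-code ×-code bool-code) from-tuple to-tuple from-to
    where
    from-tuple : _ → Registers
    from-tuple (a , b , c , d) = regs a b c d
    to-tuple : Registers → _
    to-tuple (regs a b c d) = a , b , c , d
    from-to : ∀ q → from-tuple (to-tuple q) ≡ q
    from-to (regs a b c d) = refl

  data Cursor : Set where
    cE cF cK : Cursor

  mark : Cursor → Track → Bool
  mark cE = Track.atE
  mark cF = Track.atF
  mark cK = Track.atK

  set-mark : Cursor → Bool → Track → Track
  set-mark cE v (tr d i e f k b s) = tr d i v f k b s
  set-mark cF v (tr d i e f k b s) = tr d i e v k b s
  set-mark cK v (tr d i e f k b s) = tr d i e f v b s

  bit-value : Track → Bool
  bit-value (tr nothing _ _ _ _ _ _) = false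
  bit-value (tr (just b) _ _ _ _ _ _) = b

  TrackTransducer : Set
  TrackTransducer = Registers → Track → Registers × Track

  on-tracks : TrackTransducer → Transducer Registers
  on-tracks τ q (raw r) = q , raw r
  on-tracks τ q (trk t) = proj₁ (τ q t) , trk (proj₂ (τ q t))

  -- r₀ remembers whether the next cell is in column 0.
  reset-cursor : Cursor → TrackTransducer
  reset-cursor X (regs a b c d) t@(tr nothing _ _ _ _ _ _) = regs true b c d , set-mark X a t
  reset-cursor X (regs a b c d) t@(tr (just _) _ _ _ _ _ _) = regs false b c d , set-mark X a t

  -- r₀ remembers whether the previous cell carried the mark.
  advance-cursor : Cursor → TrackTransducer
  advance-cursor X (regs a b c d) t@(tr nothing _ _ _ _ _ _) = regs false b c d , set-mark X a t
  advance-cursor X (regs a b c d) t@(tr (just _) _ _ _ _ _ _) = regs (mark X t) b c d , set-mark X a t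

  -- r₀ becomes true iff the cursor marks a separator, i.e. it has run past the last column.
  test-cursor : Cursor → TrackTransducer
  test-cursor X (regs a b c d) t@(tr nothing _ _ _ _ _ _) = regs (a ∨ mark X t) b c d , t
  test-cursor X q t@(tr (just _) _ _ _ _ _ _) = q , t

  read-where : (Track → Bool) → (Track → Bool) → TrackTransducer
  read-where cond val q t@(tr nothing _ _ _ _ _ _) = q , t
  read-where cond val (regs a b c d) t@(tr (just _) _ _ _ _ _ _) = regs (if cond t then val t else a) b c d , t

  inI∧atK : Track → Bool
  inI∧atK t = Track.inI t ∧ Track.atK t

  write-basis : Bool → TrackTransducer
  write-basis v q (tr nothing i e f k b s) = q , tr nothing i e f k b s
  write-basis v q (tr (just x) i e f k b s) = q , tr (just x) i e f k (if k then v else b) s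

  write-circuit : Bool → TrackTransducer
  write-circuit v q (tr nothing i e f k b s) = q , tr nothing i e f k b s
  write-circuit v q (tr (just x) i e f k b s) = q , tr (just x) i e f k b (if f then v else s)

  unchanged : TrackTransducer
  unchanged q t = q , t

  eqbit : Bool → Bool → Bool
  eqbit true y = y
  eqbit false y = not y

  -- Registers: some block equals basis - f + e; the current block does so far; f = e; f ∈ basis.
  search-exchange : TrackTransducer
  search-exchange (regs an el fe bf) t@(tr nothing i e f k b s) = regs (an ∨ el) true fe bf , t
  search-exchange (regs an el fe bf) t@(tr (just x) i e f k b s) =
    regs an (el ∧ eqbit x (e ∨ (b ∧ not f))) (if f then e else fe) (if f then b else bf) , t

  -- Registers: the block of Bᵢ has been reached; every earlier block B has at least two elements of
  -- circuit ─ B; the current block has at least one, at least two such elements so far.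
  check-canonical : TrackTransducer
  check-canonical (regs si ok c1 c2) t@(tr nothing i e f k b s) = regs (si ∨ i) (ok ∧ (si ∨ i ∨ c2)) false false , t
  check-canonical (regs si ok c1 c2) t@(tr (just x) i e f k b s) =
    regs si ok (c1 ∨ (s ∧ not x)) (c2 ∨ (c1 ∧ (s ∧ not x))) , t

  -- Registers: the previous block was the block of Bᵢ; the mark was moved to some block.
  advance-basis : TrackTransducer
  advance-basis (regs p pl c d) (tr nothing i e f k b s) = regs i (pl ∨ p) c d , tr nothing p e f k b s
  advance-basis (regs p pl c d) (tr (just x) i e f k b s) = regs p pl c d , tr (just x) p e f k b s

  -- Registers: the cell is in the first block; the cell is in column 0.
  initialise : Transducer Registers
  initialise (regs fi st c d) (raw (just x)) = regs fi false c d , trk (tr (just x) fi st st st false false)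
  initialise (regs fi st c d) (raw nothing) = regs false true c d , trk (tr nothing fi st st st false false)
  initialise q (trk t) = q , trk t

  data Phase : Set where
    cInit cResetKB cTestKB cBfind : Phase
    cBwrite : Bool → Phase
    cAdvKB cResetE cTestE cTestBcE cResetF cTestF cSfind : Phase
    cSwrite : Bool → Phase
    cAdvF cCanon cResetKO cTestKO cOutBit cAdvKO cOutSep cAdvE cAdvI : Phase

  phase-pass : Phase → Transducer Registers
  phase-pass cInit = initialise
  phase-pass cResetKB = on-tracks (reset-cursor cK)
  phase-pass cTestKB = on-tracks (test-cursor cK)
  phase-pass cBfind = on-tracks (read-where inI∧atK bit-value)
  phase-pass (cBwrite v) = on-tracks (write-basis v)
  phase-pass cAdvKB = on-tracks (advance-cursor cK)
  phase-pass cResetE = on-tracks (reset-cursor cE)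
  phase-pass cTestE = on-tracks (test-cursor cE)
  phase-pass cTestBcE = on-tracks (read-where Track.atE Track.basis)
  phase-pass cResetF = on-tracks (reset-cursor cF)
  phase-pass cTestF = on-tracks (test-cursor cF)
  phase-pass cSfind = on-tracks search-exchange
  phase-pass (cSwrite v) = on-tracks (write-circuit v)
  phase-pass cAdvF = on-tracks (advance-cursor cF)
  phase-pass cCanon = on-tracks check-canonical
  phase-pass cResetKO = on-tracks (reset-cursor cK)
  phase-pass cTestKO = on-tracks (test-cursor cK)
  phase-pass cOutBit = on-tracks (read-where Track.atK Track.circuit)
  phase-pass cAdvKO = on-tracks (advance-cursor cK)
  phase-pass cOutSep = on-tracks unchanged
  phase-pass cAdvE = on-tracks (advance-cursor cE)
  phase-pass cAdvI = on-tracks advance-basis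

  phase-start : Phase → Registers
  phase-start cInit = regs true true false false
  phase-start cSfind = regs false true false false
  phase-start cCanon = regs false true false false
  phase-start cResetKB = regs true false false false
  phase-start cResetE = regs true false false false
  phase-start cResetF = regs true false false false
  phase-start cResetKO = regs true false false false
  phase-start _ = regs false false false false

  phase-append : Phase → Registers → Maybe (Maybe Bool)
  phase-append cOutBit (regs a _ _ _) = just (just a)
  phase-append cOutSep _ = just nothing
  phase-append _ _ = nothing

  exchange-bit : Registers → Bool
  exchange-bit (regs an el fe bf) = fe ∨ (bf ∧ an)

  phase-next : Phase → Registers → Maybe Phase
  phase-next cInit _ = just cResetKB
  phase-next cResetKB _ = just cTestKB
  phase-next cTestKB (regs a _ _ _) = just (if a then cResetE else cBfind)
  phase-next cBfind (regs a _ _ _) = just (cBwrite a)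
  phase-next (cBwrite _) _ = just cAdvKB
  phase-next cAdvKB _ = just cTestKB
  phase-next cResetE _ = just cTestE
  phase-next cTestE (regs a _ _ _) = just (if a then cAdvI else cTestBcE)
  phase-next cTestBcE (regs a _ _ _) = just (if a then cAdvE else cResetF)
  phase-next cResetF _ = just cTestF
  phase-next cTestF (regs a _ _ _) = just (if a then cCanon else cSfind)
  phase-next cSfind q = just (cSwrite (exchange-bit q))
  phase-next (cSwrite _) _ = just cAdvF
  phase-next cAdvF _ = just cTestF
  phase-next cCanon (regs _ ok _ _) = just (if ok then cResetKO else cAdvE)
  phase-next cResetKO _ = just cTestKO
  phase-next cTestKO (regs a _ _ _) = just (if a then cOutSep else cOutBit)
  phase-next cOutBit _ = just cAdvKO
  phase-next cAdvKO _ = just cTestKO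
  phase-next cOutSep _ = just cAdvE
  phase-next cAdvE _ = just cTestE
  phase-next cAdvI (regs _ pl _ _) = if pl then just cResetKB else nothing

  phases : Vec Phase 24
  phases = cInit ∷ cResetKB ∷ cTestKB ∷ cBfind ∷ cBwrite false ∷ cBwrite true ∷ cAdvKB ∷ cResetE ∷ cTestE ∷
           cTestBcE ∷ cResetF ∷ cTestF ∷ cSfind ∷ cSwrite false ∷ cSwrite true ∷ cAdvF ∷ cCanon ∷ cResetKO ∷
           cTestKO ∷ cOutBit ∷ cAdvKO ∷ cOutSep ∷ cAdvE ∷ cAdvI ∷ []

  phase-index : Phase → Fin 24
  phase-index cInit = # 0
  phase-index cResetKB = # 1
  phase-index cTestKB = # 2
  phase-index cBfind = # 3
  phase-index (cBwrite false) = # 4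
  phase-index (cBwrite true) = # 5
  phase-index cAdvKB = # 6
  phase-index cResetE = # 7
  phase-index cTestE = # 8
  phase-index cTestBcE = # 9
  phase-index cResetF = # 10
  phase-index cTestF = # 11
  phase-index cSfind = # 12
  phase-index (cSwrite false) = # 13
  phase-index (cSwrite true) = # 14
  phase-index cAdvF = # 15
  phase-index cCanon = # 16
  phase-index cResetKO = # 17
  phase-index cTestKO = # 18
  phase-index cOutBit = # 19
  phase-index cAdvKO = # 20
  phase-index cOutSep = # 21
  phase-index cAdvE = # 22
  phase-index cAdvI = # 23

  lookup-phase-index : ∀ c → lookup phases (phase-index c) ≡ c
  lookup-phase-index cInit = refl
  lookup-phase-index cResetKB = refl
  lookup-phase-index cTestKB = refl
  lookup-phase-index cBfind = refl
  lookup-phase-index (cBwrite false) = refl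
  lookup-phase-index (cBwrite true) = refl
  lookup-phase-index cAdvKB = refl
  lookup-phase-index cResetE = refl
  lookup-phase-index cTestE = refl
  lookup-phase-index cTestBcE = refl
  lookup-phase-index cResetF = refl
  lookup-phase-index cTestF = refl
  lookup-phase-index cSfind = refl
  lookup-phase-index (cSwrite false) = refl
  lookup-phase-index (cSwrite true) = refl
  lookup-phase-index cAdvF = refl
  lookup-phase-index cCanon = refl
  lookup-phase-index cResetKO = refl
  lookup-phase-index cTestKO = refl
  lookup-phase-index cOutBit = refl
  lookup-phase-index cAdvKO = refl
  lookup-phase-index cOutSep = refl
  lookup-phase-index cAdvE = refl
  lookup-phase-index cAdvI = refl

  phase-code : FinCode Phase
  phase-code = retract-code fin-code (lookup phases) phase-index lookup-phase-index

  open Compile Phase phase-code Registers registers-code phase-start phase-pass phase-append phase-next cInit public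

module Layout (n : ℕ) (bases : List (Subset n)) where

  open import Data.Fin using (zero; suc)
  open import Data.Bool using (Bool; true; false; _∨_; if_then_else_)
  open import Data.Product using (_×_; _,_; proj₁; proj₂)
  open import Data.Maybe using (Maybe; just; nothing)
  open import Data.Vec using (Vec; []; _∷_)
  import Data.Vec
  open import Data.List.Properties using (++-assoc; map-++; ++-identityʳ)
  open import Relation.Binary.PropositionalEquality
  open import Data.Nat.Properties using (+-suc; m≤m+n)
  open import Relation.Nullary using (¬_)
  open Program

  at : ∀ {l} → Vec Bool l → ℕ → Bool
  at [] _ = false
  at (b ∷ V) zero = b
  at (b ∷ V) (suc c) = at V c

  setAt : ∀ {l} → ℕ → Bool → Vec Bool l → Vec Bool l
  setAt _ _ [] = []
  setAt zero v (b ∷ V) = v ∷ V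
  setAt (suc k) v (b ∷ V) = b ∷ setAt k v V

  at-setAt : ∀ {l} k v (V : Vec Bool l) c → c < l → at (setAt k v V) c ≡ (if c ≡ᵇ k then v else at V c)
  at-setAt k v [] c ()
  at-setAt zero v (b ∷ V) zero _ = refl
  at-setAt zero v (b ∷ V) (suc c) _ = refl
  at-setAt (suc k) v (b ∷ V) zero _ = refl
  at-setAt (suc k) v (b ∷ V) (suc c) (s≤s p) = at-setAt k v V c p

  record Store : Set where
    constructor store
    field
      i e f k : ℕ
      basis circuit : Vec Bool n
      out : List (Maybe Bool)
  open Store public

  data-track : Store → Bool → ℕ → Bool → Track
  data-track σ I c b = tr (just b) I (c ≡ᵇ e σ) (c ≡ᵇ f σ) (c ≡ᵇ k σ) (at (basis σ) c) (at (circuit σ) c)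

  separator-track : Store → Bool → ℕ → Track
  separator-track σ I c = tr nothing I (c ≡ᵇ e σ) (c ≡ᵇ f σ) (c ≡ᵇ k σ) false false

  block : Store → Bool → ℕ → ∀ {l} → Vec Bool l → List Cell
  block σ I c [] = trk (separator-track σ I c) ∷ []
  block σ I c (b ∷ B) = trk (data-track σ I c b) ∷ block σ I (suc c) B

  blocks : Store → ℕ → List (Subset n) → List Cell
  blocks σ j [] = []
  blocks σ j (B ∷ Bs) = block σ (j ≡ᵇ i σ) 0 B ++ blocks σ (suc j) Bs

  render : Store → List Cell
  render σ = blocks σ 0 bases ++ map raw (out σ)

  cursor : Cursor → Store → ℕ
  cursor cE σ = e σ
  cursor cF σ = f σ
  cursor cK σ = k σ

  choose : Cursor → Cursor → ℕ → ℕ → ℕ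
  choose cE cE v _ = v
  choose cF cF v _ = v
  choose cK cK v _ = v
  choose _ _ _ x = x

  set-cursor : Cursor → ℕ → Store → Store
  set-cursor X v σ = store (i σ) (choose cE X v (e σ)) (choose cF X v (f σ)) (choose cK X v (k σ)) (basis σ) (circuit σ) (out σ)

  transduce-++ : ∀ {A : Set} (τ : A → Cell → A × Cell) q xs ys →
            transduce τ q (xs ++ ys) ≡ (proj₁ (transduce τ (proj₁ (transduce τ q xs)) ys) , proj₂ (transduce τ q xs) ++ proj₂ (transduce τ (proj₁ (transduce τ q xs)) ys))
  transduce-++ τ q [] ys = refl
  transduce-++ τ q (x ∷ xs) ys = cong (λ p → proj₁ p , proj₂ (τ q x) ∷ proj₂ p) (transduce-++ τ (proj₁ (τ q x)) xs ys)

  transduce-raw : ∀ τ q rs → transduce (on-tracks τ) q (map raw rs) ≡ (q , map raw rs)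
  transduce-raw τ q [] = refl
  transduce-raw τ q (r ∷ rs) = cong (λ p → proj₁ p , raw r ∷ proj₂ p) (transduce-raw τ q rs)

  ReadOnly : (Registers → Track → Registers × Track) → Set
  ReadOnly τ = ∀ q t → proj₂ (τ q t) ≡ t

  read-only-cells : ∀ τ → ReadOnly τ → ∀ q u → proj₂ (transduce (on-tracks τ) q u) ≡ u
  read-only-cells τ p q [] = refl
  read-only-cells τ p q (raw r ∷ u) = cong (raw r ∷_) (read-only-cells τ p q u)
  read-only-cells τ p q (trk t ∷ u) = cong₂ (λ a b → trk a ∷ b) (p q t) (read-only-cells τ p _ u)

  pass-render : ∀ τ q σ σ' → proj₂ (transduce (on-tracks τ) q (blocks σ 0 bases)) ≡ blocks σ' 0 bases →
               proj₂ (transduce (on-tracks τ) q (render σ)) ≡ blocks σ' 0 bases ++ map raw (out σ)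
  pass-render τ q σ σ' h = trans (cong proj₂ (transduce-++ (on-tracks τ) q (blocks σ 0 bases) (map raw (out σ))))
                            (cong₂ _++_ h (cong proj₂ (transduce-raw τ _ (out σ))))

  pass-state-blocks : ∀ τ q σ → proj₁ (transduce (on-tracks τ) q (render σ)) ≡ proj₁ (transduce (on-tracks τ) q (blocks σ 0 bases))
  pass-state-blocks τ q σ = trans (cong proj₁ (transduce-++ (on-tracks τ) q (blocks σ 0 bases) (map raw (out σ))))
                      (cong proj₁ (transduce-raw τ _ (out σ)))

  reset-data : ∀ X σ I c b → set-mark X (c ≡ᵇ 0) (data-track σ I c b) ≡ data-track (set-cursor X 0 σ) I c b
  reset-data cE σ I c b = refl
  reset-data cF σ I c b = refl
  reset-data cK σ I c b = refl

  reset-separator : ∀ X σ I c → set-mark X (c ≡ᵇ 0) (separator-track σ I c) ≡ separator-track (set-cursor X 0 σ) I c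
  reset-separator cE σ I c = refl
  reset-separator cF σ I c = refl
  reset-separator cK σ I c = refl

  reset-block : ∀ X σ I c {l} (B : Vec Bool l) b' c' d' →
            transduce (on-tracks (reset-cursor X)) (regs (c ≡ᵇ 0) b' c' d') (block σ I c B) ≡ (regs true b' c' d' , block (set-cursor X 0 σ) I c B)
  reset-block X σ I c [] b' c' d' = cong (λ t → regs true b' c' d' , trk t ∷ []) (reset-separator X σ I c)
  reset-block X σ I c (b ∷ B) b' c' d' = cong₂ (λ t p → proj₁ p , trk t ∷ proj₂ p) (reset-data X σ I c b) (reset-block X σ I (suc c) B b' c' d')

  reset-blocks : ∀ X σ Bs j b' c' d' → transduce (on-tracks (reset-cursor X)) (regs true b' c' d') (blocks σ j Bs) ≡ (regs true b' c' d' , blocks (set-cursor X 0 σ) j Bs)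
  reset-blocks X σ [] j b' c' d' = refl
  reset-blocks X σ (B ∷ Bs) j b' c' d' =
    trans (transduce-++ (on-tracks (reset-cursor X)) _ (block σ (j ≡ᵇ i σ) 0 B) (blocks σ (suc j) Bs))
          (trans (cong (λ p → proj₁ (transduce (on-tracks (reset-cursor X)) (proj₁ p) (blocks σ (suc j) Bs)) , proj₂ p ++ proj₂ (transduce (on-tracks (reset-cursor X)) (proj₁ p) (blocks σ (suc j) Bs))) (reset-block X σ (j ≡ᵇ i σ) 0 B b' c' d'))
                 (cong (λ p → proj₁ p , block (set-cursor X 0 σ) (j ≡ᵇ i σ) 0 B ++ proj₂ p) (reset-blocks X σ Bs (suc j) b' c' d')))

  mark-data : ∀ X σ I c b → mark X (data-track σ I c b) ≡ (c ≡ᵇ cursor X σ)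
  mark-data cE σ I c b = refl
  mark-data cF σ I c b = refl
  mark-data cK σ I c b = refl

  advance-data : ∀ X σ I c b → set-mark X (c ≡ᵇ suc (cursor X σ)) (data-track σ I c b) ≡ data-track (set-cursor X (suc (cursor X σ)) σ) I c b
  advance-data cE σ I c b = refl
  advance-data cF σ I c b = refl
  advance-data cK σ I c b = refl

  advance-separator : ∀ X σ I c → set-mark X (c ≡ᵇ suc (cursor X σ)) (separator-track σ I c) ≡ separator-track (set-cursor X (suc (cursor X σ)) σ) I c
  advance-separator cE σ I c = refl
  advance-separator cF σ I c = refl
  advance-separator cK σ I c = refl

  advance-block : ∀ X σ I c {l} (B : Vec Bool l) b' c' d' →
          transduce (on-tracks (advance-cursor X)) (regs (c ≡ᵇ suc (cursor X σ)) b' c' d') (block σ I c B) ≡ (regs false b' c' d' , block (set-cursor X (suc (cursor X σ)) σ) I c B)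
  advance-block X σ I c [] b' c' d' = cong (λ t → regs false b' c' d' , trk t ∷ []) (advance-separator X σ I c)
  advance-block X σ I c (b ∷ B) b' c' d' =
    cong₂ (λ t p → proj₁ p , trk t ∷ proj₂ p) (advance-data X σ I c b)
      (trans (cong (λ a → transduce (on-tracks (advance-cursor X)) (regs a b' c' d') (block σ I (suc c) B)) (mark-data X σ I c b)) (advance-block X σ I (suc c) B b' c' d'))

  advance-blocks : ∀ X σ Bs j b' c' d' → transduce (on-tracks (advance-cursor X)) (regs false b' c' d') (blocks σ j Bs) ≡ (regs false b' c' d' , blocks (set-cursor X (suc (cursor X σ)) σ) j Bs)
  advance-blocks X σ [] j b' c' d' = refl
  advance-blocks X σ (B ∷ Bs) j b' c' d' =
    trans (transduce-++ (on-tracks (advance-cursor X)) _ (block σ (j ≡ᵇ i σ) 0 B) (blocks σ (suc j) Bs))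
          (trans (cong (λ p → proj₁ (transduce (on-tracks (advance-cursor X)) (proj₁ p) (blocks σ (suc j) Bs)) , proj₂ p ++ proj₂ (transduce (on-tracks (advance-cursor X)) (proj₁ p) (blocks σ (suc j) Bs))) (advance-block X σ (j ≡ᵇ i σ) 0 B b' c' d'))
                 (cong (λ p → proj₁ p , block (set-cursor X (suc (cursor X σ)) σ) (j ≡ᵇ i σ) 0 B ++ proj₂ p) (advance-blocks X σ Bs (suc j) b' c' d')))

  basis-set : Bool → Store → Store
  basis-set v σ = record σ { basis = setAt (k σ) v (basis σ) }

  circuit-set : Bool → Store → Store
  circuit-set v σ = record σ { circuit = setAt (f σ) v (circuit σ) }

  +suc≡⇒< : ∀ {N} k d → k + suc d ≡ N → k < N
  +suc≡⇒< k d h = subst (k <_) h (subst (k <_) (sym (+-suc k d)) (s≤s (m≤m+n k d)))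

  write-basis-block : ∀ v σ I c {l} (B : Vec Bool l) q → c + l ≡ n → proj₂ (transduce (on-tracks (write-basis v)) q (block σ I c B)) ≡ block (basis-set v σ) I c B
  write-basis-block v σ I c [] q h = refl
  write-basis-block v σ I c {suc l} (b ∷ B) q h = cong₂ (λ z r → trk (tr (just b) I (c ≡ᵇ e σ) (c ≡ᵇ f σ) (c ≡ᵇ k σ) z (at (circuit σ) c)) ∷ r)
    (sym (at-setAt (k σ) v (basis σ) c (+suc≡⇒< c l h))) (write-basis-block v σ I (suc c) B q (trans (sym (+-suc c l)) h))

  write-circuit-block : ∀ v σ I c {l} (B : Vec Bool l) q → c + l ≡ n → proj₂ (transduce (on-tracks (write-circuit v)) q (block σ I c B)) ≡ block (circuit-set v σ) I c B
  write-circuit-block v σ I c [] q h = refl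
  write-circuit-block v σ I c {suc l} (b ∷ B) q h = cong₂ (λ z r → trk (tr (just b) I (c ≡ᵇ e σ) (c ≡ᵇ f σ) (c ≡ᵇ k σ) (at (basis σ) c) z) ∷ r)
    (sym (at-setAt (f σ) v (circuit σ) c (+suc≡⇒< c l h))) (write-circuit-block v σ I (suc c) B q (trans (sym (+-suc c l)) h))

  blocks-cellwise : ∀ (τ : Registers → Cell → Registers × Cell) σ σ' → i σ' ≡ i σ → (∀ I (B : Vec Bool n) q → proj₂ (transduce τ q (block σ I 0 B)) ≡ block σ' I 0 B) →
              ∀ Bs j q → proj₂ (transduce τ q (blocks σ j Bs)) ≡ blocks σ' j Bs
  blocks-cellwise τ σ σ' ei h [] j q = refl
  blocks-cellwise τ σ σ' ei h (B ∷ Bs) j q =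
    trans (cong proj₂ (transduce-++ τ q (block σ (j ≡ᵇ i σ) 0 B) (blocks σ (suc j) Bs)))
          (cong₂ _++_ (trans (h (j ≡ᵇ i σ) B q) (cong (λ z → block σ' (j ≡ᵇ z) 0 B) (sym ei))) (blocks-cellwise τ σ σ' ei h Bs (suc j) _))

  next-basis : Store → Store
  next-basis σ = record σ { i = suc (i σ) }

  advance-basis-block : ∀ σ I p c {l} (B : Vec Bool l) pl c' d' →
           transduce (on-tracks advance-basis) (regs p pl c' d') (block σ I c B) ≡ (regs I (pl ∨ p) c' d' , block (next-basis σ) p c B)
  advance-basis-block σ I p c [] pl c' d' = refl
  advance-basis-block σ I p c (b ∷ B) pl c' d' = cong (λ q → proj₁ q , trk (data-track σ p c b) ∷ proj₂ q) (advance-basis-block σ I p (suc c) B pl c' d')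

  advance-basis-blocks : ∀ σ Bs j pl → proj₂ (transduce (on-tracks advance-basis) (regs (j ≡ᵇ suc (i σ)) pl false false) (blocks σ j Bs)) ≡ blocks (next-basis σ) j Bs
  advance-basis-blocks σ [] j pl = refl
  advance-basis-blocks σ (B ∷ Bs) j pl =
    trans (cong proj₂ (transduce-++ (on-tracks advance-basis) _ (block σ (j ≡ᵇ i σ) 0 B) (blocks σ (suc j) Bs)))
          (trans (cong (λ p → proj₂ p ++ proj₂ (transduce (on-tracks advance-basis) (proj₁ p) (blocks σ (suc j) Bs))) (advance-basis-block σ (j ≡ᵇ i σ) (j ≡ᵇ suc (i σ)) 0 B pl false false))
                 (cong (block (next-basis σ) (j ≡ᵇ suc (i σ)) 0 B ++_) (advance-basis-blocks σ Bs (suc j) (pl ∨ (j ≡ᵇ suc (i σ))))))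

  input-cells : List Cell
  input-cells = map raw (setsBits bases)

  at-replicate : ∀ l c → at (Data.Vec.replicate l false) c ≡ false
  at-replicate zero c = refl
  at-replicate (suc l) zero = refl
  at-replicate (suc l) (suc c) = at-replicate l c

  σ₀ : Store
  σ₀ = store 0 0 0 0 (Data.Vec.replicate n false) (Data.Vec.replicate n false) []

  initialise-block : ∀ fi c {l} (B : Vec Bool l) x y →
                     transduce initialise (regs fi (c ≡ᵇ 0) x y) (map raw (setBits B)) ≡ (regs false true x y , block σ₀ fi c B)
  initialise-block fi c [] x y = refl
  initialise-block fi c (b ∷ B) x y = cong₂ (λ t p → proj₁ p , trk t ∷ proj₂ p)
    (cong₂ (tr (just b) fi (c ≡ᵇ 0) (c ≡ᵇ 0) (c ≡ᵇ 0)) (sym (at-replicate n c)) (sym (at-replicate n c))) (initialise-block fi (suc c) B x y)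

  initialise-blocks : ∀ Bs j → proj₂ (transduce initialise (regs (j ≡ᵇ 0) true false false) (map raw (setsBits Bs))) ≡ blocks σ₀ j Bs
  initialise-blocks [] j = refl
  initialise-blocks (B ∷ Bs) j rewrite map-++ raw (setBits B) (setsBits Bs) =
    trans (cong proj₂ (transduce-++ initialise _ (map raw (setBits B)) (map raw (setsBits Bs))))
          (trans (cong (λ p → proj₂ p ++ proj₂ (transduce initialise (proj₁ p) (map raw (setsBits Bs)))) (initialise-block (j ≡ᵇ 0) 0 B false false))
                 (cong (block σ₀ (j ≡ᵇ 0) 0 B ++_) (initialise-blocks Bs (suc j))))

  pass-output-init : pass-output cInit input-cells ≡ render σ₀
  pass-output-init = cong (_++ []) (initialise-blocks bases 0)

  printed-bit : Store → Bool
  printed-bit σ = Registers.r₀ (pass-state cOutBit (render σ))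

  effect : Phase → Store → Store
  effect cInit σ = σ
  effect cResetKB σ = set-cursor cK 0 σ
  effect cTestKB σ = σ
  effect cBfind σ = σ
  effect (cBwrite v) σ = basis-set v σ
  effect cAdvKB σ = set-cursor cK (suc (k σ)) σ
  effect cResetE σ = set-cursor cE 0 σ
  effect cTestE σ = σ
  effect cTestBcE σ = σ
  effect cResetF σ = set-cursor cF 0 σ
  effect cTestF σ = σ
  effect cSfind σ = σ
  effect (cSwrite v) σ = circuit-set v σ
  effect cAdvF σ = set-cursor cF (suc (f σ)) σ
  effect cCanon σ = σ
  effect cResetKO σ = set-cursor cK 0 σ
  effect cTestKO σ = σ
  effect cOutBit σ = record σ { out = out σ ++ just (printed-bit σ) ∷ [] }
  effect cAdvKO σ = set-cursor cK (suc (k σ)) σ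
  effect cOutSep σ = record σ { out = out σ ++ nothing ∷ [] }
  effect cAdvE σ = set-cursor cE (suc (e σ)) σ
  effect cAdvI σ = next-basis σ

  nothing-appended : ∀ τ q σ σ' → proj₂ (transduce (on-tracks τ) q (render σ)) ≡ render σ' → proj₂ (transduce (on-tracks τ) q (render σ)) ++ [] ≡ render σ'
  nothing-appended τ q σ σ' h = trans (++-identityʳ _) h

  read-only-render : ∀ τ → ReadOnly τ → ∀ q σ → proj₂ (transduce (on-tracks τ) q (render σ)) ++ [] ≡ render σ
  read-only-render τ p q σ = nothing-appended τ q σ σ (read-only-cells τ p q (render σ))

  reset-render : ∀ X σ → proj₂ (transduce (on-tracks (reset-cursor X)) (regs true false false false) (render σ)) ++ [] ≡ render (set-cursor X 0 σ)
  reset-render X σ = nothing-appended _ _ σ _ (pass-render _ _ σ (set-cursor X 0 σ) (cong proj₂ (reset-blocks X σ bases 0 false false false)))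

  advance-render : ∀ X σ → proj₂ (transduce (on-tracks (advance-cursor X)) (regs false false false false) (render σ)) ++ [] ≡ render (set-cursor X (suc (cursor X σ)) σ)
  advance-render X σ = nothing-appended _ _ σ _ (pass-render _ _ σ _ (cong proj₂ (advance-blocks X σ bases 0 false false false)))

  write-basis-render : ∀ v σ q → proj₂ (transduce (on-tracks (write-basis v)) q (render σ)) ++ [] ≡ render (basis-set v σ)
  write-basis-render v σ q = nothing-appended _ _ σ _ (pass-render _ _ σ _ (blocks-cellwise _ σ (basis-set v σ) refl (λ I B q → write-basis-block v σ I 0 B q refl) bases 0 q))

  write-circuit-render : ∀ v σ q → proj₂ (transduce (on-tracks (write-circuit v)) q (render σ)) ++ [] ≡ render (circuit-set v σ)
  write-circuit-render v σ q = nothing-appended _ _ σ _ (pass-render _ _ σ _ (blocks-cellwise _ σ (circuit-set v σ) refl (λ I B q → write-circuit-block v σ I 0 B q refl) bases 0 q))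

  advance-basis-render : ∀ σ → proj₂ (transduce (on-tracks advance-basis) (regs false false false false) (render σ)) ++ [] ≡ render (next-basis σ)
  advance-basis-render σ = nothing-appended _ _ σ _ (pass-render _ _ σ _ (advance-basis-blocks σ bases 0 false))

  test-read-only : ∀ X → ReadOnly (test-cursor X)
  test-read-only X (regs a b c d) (tr nothing _ _ _ _ _ _) = refl
  test-read-only X (regs a b c d) (tr (just _) _ _ _ _ _ _) = refl

  read-read-only : ∀ g h → ReadOnly (read-where g h)
  read-read-only g h (regs a b c d) (tr nothing _ _ _ _ _ _) = refl
  read-read-only g h (regs a b c d) (tr (just _) _ _ _ _ _ _) = refl

  search-read-only : ReadOnly search-exchange
  search-read-only (regs a b c d) (tr nothing _ _ _ _ _ _) = refl
  search-read-only (regs a b c d) (tr (just _) _ _ _ _ _ _) = refl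

  canonical-read-only : ReadOnly check-canonical
  canonical-read-only (regs a b c d) (tr nothing _ _ _ _ _ _) = refl
  canonical-read-only (regs a b c d) (tr (just _) _ _ _ _ _ _) = refl

  unchanged-read-only : ReadOnly unchanged
  unchanged-read-only q t = refl

  block-out : ∀ σ o I c {l} (B : Vec Bool l) → block (record σ { out = o }) I c B ≡ block σ I c B
  block-out σ o I c [] = refl
  block-out σ o I c (b ∷ B) = cong (trk (data-track σ I c b) ∷_) (block-out σ o I (suc c) B)

  blocks-out : ∀ σ o j Bs → blocks (record σ { out = o }) j Bs ≡ blocks σ j Bs
  blocks-out σ o j [] = refl
  blocks-out σ o j (B ∷ Bs) = cong₂ _++_ (block-out σ o _ 0 B) (blocks-out σ o (suc j) Bs)

  append-render : ∀ τ q σ r → proj₂ (transduce (on-tracks τ) q (render σ)) ≡ render σ →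
         proj₂ (transduce (on-tracks τ) q (render σ)) ++ raw r ∷ [] ≡ render (record σ { out = out σ ++ r ∷ [] })
  append-render τ q σ r h = trans (cong (_++ raw r ∷ []) h)
    (trans (++-assoc (blocks σ 0 bases) (map raw (out σ)) (raw r ∷ [])) (cong₂ _++_ (sym (blocks-out σ (out σ ++ r ∷ []) 0 bases)) (sym (map-++ raw (out σ) (r ∷ [])))))

  pass-output-render : ∀ c σ → ¬ (c ≡ cInit) → pass-output c (render σ) ≡ render (effect c σ)
  pass-output-render cInit σ ne with ne refl
  ... | ()
  pass-output-render cResetKB σ _ = reset-render cK σ
  pass-output-render cTestKB σ _ = read-only-render _ (test-read-only cK) _ σ
  pass-output-render cBfind σ _ = read-only-render _ (read-read-only _ _) _ σ
  pass-output-render (cBwrite v) σ _ = write-basis-render v σ _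
  pass-output-render cAdvKB σ _ = advance-render cK σ
  pass-output-render cResetE σ _ = reset-render cE σ
  pass-output-render cTestE σ _ = read-only-render _ (test-read-only cE) _ σ
  pass-output-render cTestBcE σ _ = read-only-render _ (read-read-only _ _) _ σ
  pass-output-render cResetF σ _ = reset-render cF σ
  pass-output-render cTestF σ _ = read-only-render _ (test-read-only cF) _ σ
  pass-output-render cSfind σ _ = read-only-render _ search-read-only _ σ
  pass-output-render (cSwrite v) σ _ = write-circuit-render v σ _
  pass-output-render cAdvF σ _ = advance-render cF σ
  pass-output-render cCanon σ _ = read-only-render _ canonical-read-only _ σ
  pass-output-render cResetKO σ _ = reset-render cK σ
  pass-output-render cTestKO σ _ = read-only-render _ (test-read-only cK) _ σ
  pass-output-render cOutBit σ _ = append-render _ _ σ _ (read-only-cells _ (read-read-only _ _) _ (render σ))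
  pass-output-render cAdvKO σ _ = advance-render cK σ
  pass-output-render cOutSep σ _ = append-render _ _ σ _ (read-only-cells _ unchanged-read-only _ (render σ))
  pass-output-render cAdvE σ _ = advance-render cE σ
  pass-output-render cAdvI σ _ = advance-basis-render σ


module Execution (n : ℕ) (B0 : Vec Bool n) (Bs : List (Subset n)) where

  open import Data.Bool using (Bool)
  open import Data.Product using (_×_; _,_; Σ)
  open import Data.Maybe using (just; nothing)
  open import Data.List.Properties using (length-++; length-map)
  open import Data.Nat.Properties
  open import Relation.Binary.PropositionalEquality
  open import Relation.Nullary using (¬_)
  open Program
  open Layout n (B0 ∷ Bs) public

  bases : List (Subset n)
  bases = B0 ∷ Bs

  m : ℕ
  m = length bases

  -- At most n circuits of n + 1 symbols are printed per basis.
  Ω : ℕ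
  Ω = m * (n * suc n)

  K : ℕ
  K = 2 * (m * suc n + Ω) + 2

  StepsWithin : ℕ → Conf → Conf → Set
  StepsWithin t a b = Σ ℕ λ j → j ≤ t × Steps j a b

  length-block : ∀ σ I c {l} (B : Vec Bool l) → length (block σ I c B) ≡ suc l
  length-block σ I c [] = refl
  length-block σ I c (b ∷ B) = cong suc (length-block σ I (suc c) B)

  length-blocks : ∀ σ j (Cs : List (Subset n)) → length (blocks σ j Cs) ≡ length Cs * suc n
  length-blocks σ j [] = refl
  length-blocks σ j (B ∷ Cs) = trans (length-++ (block σ (j ≡ᵇ i σ) 0 B)) (cong₂ _+_ (length-block σ _ 0 B) (length-blocks σ (suc j) Cs))

  length-render : ∀ σ → length (render σ) ≡ m * suc n + length (out σ)
  length-render σ = trans (length-++ (blocks σ 0 bases)) (cong₂ _+_ (length-blocks σ 0 bases) (length-map raw (out σ)))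

  Shows : Control → Store → Conf → Set
  Shows st σ a = Loaded a st (render σ)

  -- From phase c on the tape of σ, the machine reaches control st on the tape of σ' within p passes.
  -- A pass costs at most K steps as long as the output is at most Ω long, and outputs only grow.
  record Run (p : ℕ) (c : Phase) (σ : Store) (st : Control) (σ' : Store) : Set where
    constructor _,_
    field
      out-grows : length (out σ) ≤ length (out σ')
      simulate : length (out σ') ≤ Ω → ∀ a → Shows (entering c) σ a → Σ Conf λ b → Shows st σ' b × StepsWithin (p * K) a b

  out-mono : ∀ c σ → length (out σ) ≤ length (out (effect c σ))
  out-mono cInit σ = ≤-refl
  out-mono cResetKB σ = ≤-refl
  out-mono cTestKB σ = ≤-refl
  out-mono cBfind σ = ≤-refl
  out-mono (cBwrite x) σ = ≤-refl
  out-mono cAdvKB σ = ≤-refl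
  out-mono cResetE σ = ≤-refl
  out-mono cTestE σ = ≤-refl
  out-mono cTestBcE σ = ≤-refl
  out-mono cResetF σ = ≤-refl
  out-mono cTestF σ = ≤-refl
  out-mono cSfind σ = ≤-refl
  out-mono (cSwrite x) σ = ≤-refl
  out-mono cAdvF σ = ≤-refl
  out-mono cCanon σ = ≤-refl
  out-mono cResetKO σ = ≤-refl
  out-mono cTestKO σ = ≤-refl
  out-mono cOutBit σ = subst (length (out σ) ≤_) (sym (length-++ (out σ))) (m≤m+n _ _)
  out-mono cAdvKO σ = ≤-refl
  out-mono cOutSep σ = subst (length (out σ) ≤_) (sym (length-++ (out σ))) (m≤m+n _ _)
  out-mono cAdvE σ = ≤-refl
  out-mono cAdvI σ = ≤-refl

  pass-cost : ∀ σ → length (out σ) ≤ Ω → 2 * length (render σ) + 2 ≤ 1 * K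
  pass-cost σ out≤Ω rewrite length-render σ | *-identityˡ K =
    +-monoˡ-≤ 2 (*-monoʳ-≤ 2 (+-monoʳ-≤ (m * suc n) out≤Ω))

  pass-run : ∀ c σ → ¬ (c ≡ cInit) → Run 1 c σ (resume (pass-next c (render σ))) (effect c σ)
  pass-run c σ c≢init = out-mono c σ , λ out≤Ω a a-at →
    let (b , b-loaded , steps) = pass-steps c (render σ) a a-at
    in b , subst (Loaded b (resume (pass-next c (render σ)))) (pass-output-render c σ c≢init) b-loaded ,
       _ , pass-cost σ (≤-trans (out-mono c σ) out≤Ω) , steps

  pass-to : ∀ c σ c' → ¬ (c ≡ cInit) → pass-next c (render σ) ≡ just c' → Run 1 c σ (entering c') (effect c σ)
  pass-to c σ c' ne eq = subst (λ z → Run 1 c σ (resume z) (effect c σ)) eq (pass-run c σ ne)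

  pass-end : ∀ c σ → ¬ (c ≡ cInit) → pass-next c (render σ) ≡ nothing → Run 1 c σ seeking (effect c σ)
  pass-end c σ ne eq = subst (λ z → Run 1 c σ (resume z) (effect c σ)) eq (pass-run c σ ne)

  infixr 4 _⨾_

  _⨾_ : ∀ {p p' c σ c' σ' st σ''} → Run p c σ (entering c') σ' → Run p' c' σ' st σ'' → Run (p + p') c σ st σ''
  _⨾_ {p} {p'} (m1 , r1) (m2 , r2) = ≤-trans m1 m2 , λ yΩ a at →
    let (b , atb , j1 , j1≤ , s1) = r1 (≤-trans m2 yΩ) a at
        (c , atc , j2 , j2≤ , s2) = r2 yΩ b atb
    in c , atc , j1 + j2 , subst (j1 + j2 ≤_) (sym (*-distribʳ-+ K p p')) (+-mono-≤ j1≤ j2≤) , (s1 ▷ s2)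

  Run-weaken : ∀ {p p' c σ st σ'} → p ≤ p' → Run p c σ st σ' → Run p' c σ st σ'
  Run-weaken {p} {p'} le (m1 , r1) = m1 , λ yΩ a at →
    let (b , atb , j , j≤ , s) = r1 yΩ a at in b , atb , j , ≤-trans j≤ (*-monoˡ-≤ K le) , s

  Run-store : ∀ {p c σ st σ' σ''} → σ' ≡ σ'' → Run p c σ st σ' → Run p c σ st σ''
  Run-store refl r = r


module PassResults (n : ℕ) (B0 : Vec Bool n) (Bs : List (Subset n)) where

  open import Data.Product using (proj₁)
  open import Data.Nat.Properties
  open import Data.Bool.Properties using (∨-idem; ∨-identityʳ; ∨-zeroʳ)
  open import Relation.Binary.PropositionalEquality
  open import Relation.Nullary using (¬_)
  open import Data.Empty using (⊥-elim)
  import Data.Empty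
  open Program
  open Layout n (B0 ∷ Bs)

  bases : List (Subset n)
  bases = B0 ∷ Bs

  ≡ᵇ-refl : ∀ c → (c ≡ᵇ c) ≡ true
  ≡ᵇ-refl zero = refl
  ≡ᵇ-refl (suc c) = ≡ᵇ-refl c

  ≡ᵇ-≢ : ∀ c x → ¬ (c ≡ x) → (c ≡ᵇ x) ≡ false
  ≡ᵇ-≢ zero zero ne = ⊥-elim (ne refl)
  ≡ᵇ-≢ zero (suc x) ne = refl
  ≡ᵇ-≢ (suc c) zero ne = refl
  ≡ᵇ-≢ (suc c) (suc x) ne = ≡ᵇ-≢ c x (λ e → ne (cong suc e))

  ≡ᵇ-true⇒≡ : ∀ c x → (c ≡ᵇ x) ≡ true → c ≡ x
  ≡ᵇ-true⇒≡ zero zero _ = refl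
  ≡ᵇ-true⇒≡ (suc c) (suc x) h = cong suc (≡ᵇ-true⇒≡ c x h)

  mark-separator : ∀ X σ I c → mark X (separator-track σ I c) ≡ (c ≡ᵇ cursor X σ)
  mark-separator cE σ I c = refl
  mark-separator cF σ I c = refl
  mark-separator cK σ I c = refl

  test-block : ∀ X σ I c {l} (B : Vec Bool l) a b' c' d' → c + l ≡ n →
           proj₁ (transduce (on-tracks (test-cursor X)) (regs a b' c' d') (block σ I c B)) ≡ regs (a ∨ (n ≡ᵇ cursor X σ)) b' c' d'
  test-block X σ I c [] a b' c' d' h = cong (λ z → regs (a ∨ z) b' c' d') (trans (mark-separator X σ I c) (cong (_≡ᵇ cursor X σ) (trans (sym (+-identityʳ c)) h)))
  test-block X σ I c {suc l} (b ∷ B) a b' c' d' h = test-block X σ I (suc c) B a b' c' d' (trans (sym (+-suc c l)) h)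

  test-blocks : ∀ X σ Cs j b' c' d' → proj₁ (transduce (on-tracks (test-cursor X)) (regs (n ≡ᵇ cursor X σ) b' c' d') (blocks σ j Cs)) ≡ regs (n ≡ᵇ cursor X σ) b' c' d'
  test-blocks X σ [] j b' c' d' = refl
  test-blocks X σ (B ∷ Cs) j b' c' d' =
    trans (cong proj₁ (transduce-++ (on-tracks (test-cursor X)) _ (block σ (j ≡ᵇ i σ) 0 B) (blocks σ (suc j) Cs)))
      (trans (cong (λ q → proj₁ (transduce (on-tracks (test-cursor X)) q (blocks σ (suc j) Cs)))
                   (trans (test-block X σ (j ≡ᵇ i σ) 0 B _ b' c' d' refl) (cong (λ z → regs z b' c' d') (∨-idem _))))
             (test-blocks X σ Cs (suc j) b' c' d'))

  test-result : ∀ X σ → Registers.r₀ (proj₁ (transduce (on-tracks (test-cursor X)) (regs false false false false) (render σ))) ≡ (n ≡ᵇ cursor X σ)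
  test-result X σ = cong Registers.r₀ (trans (pass-state-blocks (test-cursor X) _ σ)
    (trans (cong proj₁ (transduce-++ (on-tracks (test-cursor X)) _ (block σ (0 ≡ᵇ i σ) 0 B0) (blocks σ 1 Bs)))
      (trans (cong (λ q → proj₁ (transduce (on-tracks (test-cursor X)) q (blocks σ 1 Bs))) (test-block X σ (0 ≡ᵇ i σ) 0 B0 false false false false refl))
             (test-blocks X σ Bs 1 false false false))))

  read-column : ℕ → (ℕ → Bool → Bool) → ℕ → ∀ {l} → Vec Bool l → Bool → Bool
  read-column x V c [] a = a
  read-column x V c (b ∷ B) a = read-column x V (suc c) B (if c ≡ᵇ x then V c b else a)

  read-block : ∀ cnd vl σ I x (V : ℕ → Bool → Bool) → (∀ c b → cnd (data-track σ I c b) ≡ (c ≡ᵇ x)) → (∀ c b → vl (data-track σ I c b) ≡ V c b) →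
           ∀ c {l} (B : Vec Bool l) a b' c' d' →
           proj₁ (transduce (on-tracks (read-where cnd vl)) (regs a b' c' d') (block σ I c B)) ≡ regs (read-column x V c B a) b' c' d'
  read-block cnd vl σ I x V hc hv c [] a b' c' d' = refl
  read-block cnd vl σ I x V hc hv c (b ∷ B) a b' c' d' =
    trans (cong (λ z → proj₁ (transduce (on-tracks (read-where cnd vl)) (regs z b' c' d') (block σ I (suc c) B)))
                (cong₂ (λ p q → if p then q else a) (hc c b) (hv c b)))
          (read-block cnd vl σ I x V hc hv (suc c) B _ b' c' d')

  read-column-miss : ∀ x V c {l} (B : Vec Bool l) a → x < c → read-column x V c B a ≡ a
  read-column-miss x V c [] a lt = refl
  read-column-miss x V c (b ∷ B) a lt =
    trans (cong (read-column x V (suc c) B) (cong (λ z → if z then V c b else a) (≡ᵇ-≢ c x (λ e → <-irrefl (sym e) lt))))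
          (read-column-miss x V (suc c) B a (≤-trans lt (n≤1+n c)))

  read-column-hit : ∀ x V d c {l} (B : Vec Bool l) a → x ≡ c + d → d < l → read-column x V c B a ≡ V x (at B d)
  read-column-hit x V zero c (b ∷ B) a h lt =
    trans (cong (read-column x V (suc c) B) (cong (λ z → if z then V c b else a) (trans (cong (c ≡ᵇ_) h) (trans (cong (c ≡ᵇ_) (+-identityʳ c)) (≡ᵇ-refl c)))))
          (trans (read-column-miss x V (suc c) B _ (subst (_< suc c) (sym (trans h (+-identityʳ c))) (n<1+n c)))
                 (cong (λ z → V z b) (sym (trans h (+-identityʳ c)))))
  read-column-hit x V (suc d) c (b ∷ B) a h (s≤s lt) =
    trans (cong (read-column x V (suc c) B) (cong (λ z → if z then V c b else a) (≡ᵇ-≢ c x (λ e → ne e))))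
          (read-column-hit x V d (suc c) B _ (trans h (+-suc c d)) lt)
    where
    ne : c ≡ x → Data.Empty.⊥
    ne e = <-irrefl (trans e h) (m<m+n c (s≤s z≤n))

  read-column-at : ∀ x V (B : Vec Bool n) a → x < n → read-column x V 0 B a ≡ V x (at B x)
  read-column-at x V B a lt = read-column-hit x V x 0 B a refl lt

  read-uniform-blocks : ∀ cnd vl σ x (W : ℕ → Bool) → x < n →
          (∀ I c b → cnd (data-track σ I c b) ≡ (c ≡ᵇ x)) → (∀ I c b → vl (data-track σ I c b) ≡ W c) →
          ∀ Cs j b' c' d' → proj₁ (transduce (on-tracks (read-where cnd vl)) (regs (W x) b' c' d') (blocks σ j Cs)) ≡ regs (W x) b' c' d'
  read-uniform-blocks cnd vl σ x W lt hc hv [] j b' c' d' = refl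
  read-uniform-blocks cnd vl σ x W lt hc hv (B ∷ Cs) j b' c' d' =
    trans (cong proj₁ (transduce-++ (on-tracks (read-where cnd vl)) _ (block σ (j ≡ᵇ i σ) 0 B) (blocks σ (suc j) Cs)))
      (trans (cong (λ q → proj₁ (transduce (on-tracks (read-where cnd vl)) q (blocks σ (suc j) Cs)))
                   (trans (read-block cnd vl σ (j ≡ᵇ i σ) x (λ c _ → W c) (hc _) (hv _) 0 B _ b' c' d')
                          (cong (λ z → regs z b' c' d') (read-column-at x (λ c _ → W c) B _ lt))))
             (read-uniform-blocks cnd vl σ x W lt hc hv Cs (suc j) b' c' d'))

  read-uniform-result : ∀ cnd vl σ x (W : ℕ → Bool) → x < n →
          (∀ I c b → cnd (data-track σ I c b) ≡ (c ≡ᵇ x)) → (∀ I c b → vl (data-track σ I c b) ≡ W c) →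
          Registers.r₀ (proj₁ (transduce (on-tracks (read-where cnd vl)) (regs false false false false) (render σ))) ≡ W x
  read-uniform-result cnd vl σ x W lt hc hv = cong Registers.r₀ (trans (pass-state-blocks (read-where cnd vl) _ σ)
    (trans (cong proj₁ (transduce-++ (on-tracks (read-where cnd vl)) _ (block σ (0 ≡ᵇ i σ) 0 B0) (blocks σ 1 Bs)))
      (trans (cong (λ q → proj₁ (transduce (on-tracks (read-where cnd vl)) q (blocks σ 1 Bs)))
                   (trans (read-block cnd vl σ (0 ≡ᵇ i σ) x (λ c _ → W c) (hc _) (hv _) 0 B0 false false false false)
                          (cong (λ z → regs z false false false) (read-column-at x (λ c _ → W c) B0 _ lt))))
             (read-uniform-blocks cnd vl σ x W lt hc hv Bs 1 false false false))))

  basis-bit-result : ∀ σ → e σ < n → Registers.r₀ (pass-state cTestBcE (render σ)) ≡ at (basis σ) (e σ)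
  basis-bit-result σ lt = read-uniform-result Track.atE Track.basis σ (e σ) (at (basis σ)) lt (λ I c b → refl) (λ I c b → refl)

  printed-bit-result : ∀ σ → k σ < n → printed-bit σ ≡ at (circuit σ) (k σ)
  printed-bit-result σ lt = read-uniform-result Track.atK Track.circuit σ (k σ) (at (circuit σ)) lt (λ I c b → refl) (λ I c b → refl)

  nth : List (Subset n) → ℕ → Subset n
  nth [] _ = Data.Vec.replicate n false
  nth (B ∷ Cs) zero = B
  nth (B ∷ Cs) (suc d) = nth Cs d

  read-block-outside : ∀ σ c {l} (B : Vec Bool l) a b' c' d' →
           proj₁ (transduce (on-tracks (read-where inI∧atK bit-value)) (regs a b' c' d') (block σ false c B)) ≡ regs a b' c' d'
  read-block-outside σ c [] a b' c' d' = refl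
  read-block-outside σ c (b ∷ B) a b' c' d' = read-block-outside σ (suc c) B a b' c' d'

  bfStep : ∀ σ j (B : Vec Bool n) Cs a → proj₁ (transduce (on-tracks (read-where inI∧atK bit-value)) (regs a false false false) (blocks σ j (B ∷ Cs))) ≡
           proj₁ (transduce (on-tracks (read-where inI∧atK bit-value)) (proj₁ (transduce (on-tracks (read-where inI∧atK bit-value)) (regs a false false false) (block σ (j ≡ᵇ i σ) 0 B))) (blocks σ (suc j) Cs))
  bfStep σ j B Cs a = cong proj₁ (transduce-++ (on-tracks (read-where inI∧atK bit-value)) _ (block σ (j ≡ᵇ i σ) 0 B) (blocks σ (suc j) Cs))

  read-basis-miss : ∀ σ Cs j a → i σ < j → proj₁ (transduce (on-tracks (read-where inI∧atK bit-value)) (regs a false false false) (blocks σ j Cs)) ≡ regs a false false false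
  read-basis-miss σ [] j a lt = refl
  read-basis-miss σ (B ∷ Cs) j a lt =
    trans (bfStep σ j B Cs a)
      (trans (cong (λ I → proj₁ (transduce (on-tracks (read-where inI∧atK bit-value)) (proj₁ (transduce (on-tracks (read-where inI∧atK bit-value)) (regs a false false false) (block σ I 0 B))) (blocks σ (suc j) Cs)))
                   (≡ᵇ-≢ j (i σ) (λ e → <-irrefl (sym e) lt)))
        (trans (cong (λ q → proj₁ (transduce (on-tracks (read-where inI∧atK bit-value)) q (blocks σ (suc j) Cs))) (read-block-outside σ 0 B a false false false))
               (read-basis-miss σ Cs (suc j) a (≤-trans lt (n≤1+n j)))))

  read-basis-hit : ∀ σ d Cs j a → i σ ≡ j + d → d < length Cs → k σ < n →
          Registers.r₀ (proj₁ (transduce (on-tracks (read-where inI∧atK bit-value)) (regs a false false false) (blocks σ j Cs))) ≡ at (nth Cs d) (k σ)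
  read-basis-hit σ zero (B ∷ Cs) j a h lt kl =
    trans (cong Registers.r₀ (bfStep σ j B Cs a))
      (trans (cong (λ I → Registers.r₀ (proj₁ (transduce (on-tracks (read-where inI∧atK bit-value)) (proj₁ (transduce (on-tracks (read-where inI∧atK bit-value)) (regs a false false false) (block σ I 0 B))) (blocks σ (suc j) Cs))))
                   (trans (cong (j ≡ᵇ_) (trans h (+-identityʳ j))) (≡ᵇ-refl j)))
        (trans (cong (λ q → Registers.r₀ (proj₁ (transduce (on-tracks (read-where inI∧atK bit-value)) q (blocks σ (suc j) Cs))))
                     (trans (read-block inI∧atK bit-value σ true (k σ) (λ _ b → b) (λ c b → refl) (λ c b → refl) 0 B a false false false)
                            (cong (λ z → regs z false false false) (read-column-at (k σ) (λ _ b → b) B a kl))))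
               (cong Registers.r₀ (read-basis-miss σ Cs (suc j) _ (subst (_< suc j) (sym (trans h (+-identityʳ j))) (n<1+n j))))))
  read-basis-hit σ (suc d) (B ∷ Cs) j a h (s≤s lt) kl =
    trans (cong Registers.r₀ (bfStep σ j B Cs a))
      (trans (cong (λ I → Registers.r₀ (proj₁ (transduce (on-tracks (read-where inI∧atK bit-value)) (proj₁ (transduce (on-tracks (read-where inI∧atK bit-value)) (regs a false false false) (block σ I 0 B))) (blocks σ (suc j) Cs))))
                   (≡ᵇ-≢ j (i σ) (λ e → <-irrefl (trans e h) (m<m+n j (s≤s z≤n)))))
        (trans (cong (λ q → Registers.r₀ (proj₁ (transduce (on-tracks (read-where inI∧atK bit-value)) q (blocks σ (suc j) Cs)))) (read-block-outside σ 0 B a false false false))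
               (read-basis-hit σ d Cs (suc j) a (trans h (+-suc j d)) lt kl)))

  basis-read-result : ∀ σ → i σ < length bases → k σ < n → Registers.r₀ (pass-state cBfind (render σ)) ≡ at (nth bases (i σ)) (k σ)
  basis-read-result σ il kl = trans (cong Registers.r₀ (pass-state-blocks (read-where inI∧atK bit-value) _ σ)) (read-basis-hit σ (i σ) bases 0 false refl il kl)

  -- Column c of V - f + e.
  exchange-column : Vec Bool n → ℕ → ℕ → ℕ → Bool
  exchange-column V e f c = (c ≡ᵇ e) ∨ (at V c ∧ not (c ≡ᵇ f))

  agrees-exchange : Vec Bool n → ℕ → ℕ → ℕ → Bool → Bool
  agrees-exchange V e f c b = eqbit b (exchange-column V e f c)

  block-is-exchange : Vec Bool n → ℕ → ℕ → ℕ → ∀ {l} → Vec Bool l → Bool → Bool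
  block-is-exchange V e f c [] el = el
  block-is-exchange V e f c (b ∷ B) el = block-is-exchange V e f (suc c) B (el ∧ agrees-exchange V e f c b)

  search-block : ∀ σ I c {l} (B : Vec Bool l) an el fe bf →
         proj₁ (transduce (on-tracks search-exchange) (regs an el fe bf) (block σ I c B)) ≡
         regs (an ∨ block-is-exchange (basis σ) (e σ) (f σ) c B el) true (read-column (f σ) (λ c _ → c ≡ᵇ e σ) c B fe) (read-column (f σ) (λ c _ → at (basis σ) c) c B bf)
  search-block σ I c [] an el fe bf = refl
  search-block σ I c (b ∷ B) an el fe bf = search-block σ I (suc c) B an _ _ _

  exchange-listed : Vec Bool n → ℕ → ℕ → Bool → List (Subset n) → Bool
  exchange-listed V e f an [] = an
  exchange-listed V e f an (B ∷ Cs) = exchange-listed V e f (an ∨ block-is-exchange V e f 0 B true) Cs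

  search-blocks : ∀ σ → f σ < n → ∀ Cs j an →
             proj₁ (transduce (on-tracks search-exchange) (regs an true (f σ ≡ᵇ e σ) (at (basis σ) (f σ))) (blocks σ j Cs)) ≡
             regs (exchange-listed (basis σ) (e σ) (f σ) an Cs) true (f σ ≡ᵇ e σ) (at (basis σ) (f σ))
  search-blocks σ lt [] j an = refl
  search-blocks σ lt (B ∷ Cs) j an =
    trans (cong proj₁ (transduce-++ (on-tracks search-exchange) _ (block σ (j ≡ᵇ i σ) 0 B) (blocks σ (suc j) Cs)))
      (trans (cong (λ q → proj₁ (transduce (on-tracks search-exchange) q (blocks σ (suc j) Cs)))
                   (trans (search-block σ (j ≡ᵇ i σ) 0 B an true _ _)
                          (cong₂ (λ x y → regs (an ∨ block-is-exchange (basis σ) (e σ) (f σ) 0 B true) true x y)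
                                 (read-column-at (f σ) (λ c _ → c ≡ᵇ e σ) B _ lt) (read-column-at (f σ) (λ c _ → at (basis σ) c) B _ lt))))
             (search-blocks σ lt Cs (suc j) _))

  exchange-bit-result : ∀ σ → f σ < n → exchange-bit (pass-state cSfind (render σ)) ≡ ((f σ ≡ᵇ e σ) ∨ (at (basis σ) (f σ) ∧ exchange-listed (basis σ) (e σ) (f σ) false bases))
  exchange-bit-result σ lt = cong exchange-bit (trans (pass-state-blocks search-exchange _ σ)
    (trans (cong proj₁ (transduce-++ (on-tracks search-exchange) _ (block σ (0 ≡ᵇ i σ) 0 B0) (blocks σ 1 Bs)))
      (trans (cong (λ q → proj₁ (transduce (on-tracks search-exchange) q (blocks σ 1 Bs)))
                   (trans (search-block σ (0 ≡ᵇ i σ) 0 B0 false true false false)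
                          (cong₂ (λ x y → regs (block-is-exchange (basis σ) (e σ) (f σ) 0 B0 true) true x y)
                                 (read-column-at (f σ) (λ c _ → c ≡ᵇ e σ) B0 _ lt) (read-column-at (f σ) (λ c _ → at (basis σ) c) B0 _ lt))))
             (search-blocks σ lt Bs 1 _))))

  in-range : ℕ → ℕ → List (Subset n) → Bool → Bool
  in-range x j [] pl = pl
  in-range x j (B ∷ Cs) pl = in-range x (suc j) Cs (pl ∨ (j ≡ᵇ x))

  advance-basis-state : ∀ σ Cs j pl → Registers.r₁ (proj₁ (transduce (on-tracks advance-basis) (regs (j ≡ᵇ suc (i σ)) pl false false) (blocks σ j Cs))) ≡ in-range (suc (i σ)) j Cs pl
  advance-basis-state σ [] j pl = refl
  advance-basis-state σ (B ∷ Cs) j pl =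
    trans (cong (λ p → Registers.r₁ (proj₁ p)) (transduce-++ (on-tracks advance-basis) _ (block σ (j ≡ᵇ i σ) 0 B) (blocks σ (suc j) Cs)))
      (trans (cong (λ q → Registers.r₁ (proj₁ (transduce (on-tracks advance-basis) q (blocks σ (suc j) Cs)))) (cong proj₁ (advance-basis-block σ (j ≡ᵇ i σ) (j ≡ᵇ suc (i σ)) 0 B pl false false)))
             (advance-basis-state σ Cs (suc j) (pl ∨ (j ≡ᵇ suc (i σ)))))

  in-range-true : ∀ x j Cs → in-range x j Cs true ≡ true
  in-range-true x j [] = refl
  in-range-true x j (B ∷ Cs) = in-range-true x (suc j) Cs

  in-range-hit : ∀ x d j Cs pl → x ≡ j + d → d < length Cs → in-range x j Cs pl ≡ true
  in-range-hit x zero j (B ∷ Cs) pl h lt =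
    trans (cong (λ z → in-range x (suc j) Cs (pl ∨ z)) (trans (cong (j ≡ᵇ_) (trans h (+-identityʳ j))) (≡ᵇ-refl j)))
          (trans (cong (λ z → in-range x (suc j) Cs z) (∨-zeroʳ pl)) (in-range-true x (suc j) Cs))
  in-range-hit x (suc d) j (B ∷ Cs) pl h (s≤s lt) = in-range-hit x d (suc j) Cs _ (trans h (+-suc j d)) lt

  in-range-miss : ∀ x j Cs pl → j + length Cs ≤ x → in-range x j Cs pl ≡ pl
  in-range-miss x j [] pl le = refl
  in-range-miss x j (B ∷ Cs) pl le =
    trans (cong (λ z → in-range x (suc j) Cs (pl ∨ z)) (≡ᵇ-≢ j x (λ e → <-irrefl e (≤-trans (m<m+n j (s≤s z≤n)) le))))
      (trans (cong (λ z → in-range x (suc j) Cs z) (∨-identityʳ pl)) (in-range-miss x (suc j) Cs pl (subst (_≤ x) (+-suc j (length Cs)) le)))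

  advance-basis-result : ∀ σ → Registers.r₁ (pass-state cAdvI (render σ)) ≡ in-range (suc (i σ)) 0 bases false
  advance-basis-result σ = trans (cong Registers.r₁ (pass-state-blocks advance-basis _ σ)) (advance-basis-state σ bases 0 false)

  outside-at : Vec Bool n → ℕ → Bool → Bool
  outside-at S c b = at S c ∧ not b

  two-outside-from : Vec Bool n → ℕ → ∀ {l} → Vec Bool l → Bool → Bool → Bool
  two-outside-from S c [] c1 c2 = c2
  two-outside-from S c (b ∷ B) c1 c2 = two-outside-from S (suc c) B (c1 ∨ outside-at S c b) (c2 ∨ (c1 ∧ outside-at S c b))

  canonical-block : ∀ σ I c {l} (B : Vec Bool l) si ok c1 c2 →
          proj₁ (transduce (on-tracks check-canonical) (regs si ok c1 c2) (block σ I c B)) ≡ regs (si ∨ I) (ok ∧ (si ∨ I ∨ two-outside-from (circuit σ) c B c1 c2)) false false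
  canonical-block σ I c [] si ok c1 c2 = refl
  canonical-block σ I c (b ∷ B) si ok c1 c2 = canonical-block σ I (suc c) B si ok _ _

  canonical-from : Vec Bool n → ℕ → ℕ → List (Subset n) → Bool → Bool → Bool
  canonical-from S i j [] si ok = ok
  canonical-from S i j (B ∷ Cs) si ok = canonical-from S i (suc j) Cs (si ∨ (j ≡ᵇ i)) (ok ∧ (si ∨ (j ≡ᵇ i) ∨ two-outside-from S 0 B false false))

  canonical-blocks : ∀ σ Cs j si ok → Registers.r₁ (proj₁ (transduce (on-tracks check-canonical) (regs si ok false false) (blocks σ j Cs))) ≡ canonical-from (circuit σ) (i σ) j Cs si ok
  canonical-blocks σ [] j si ok = refl
  canonical-blocks σ (B ∷ Cs) j si ok =
    trans (cong (λ p → Registers.r₁ (proj₁ p)) (transduce-++ (on-tracks check-canonical) _ (block σ (j ≡ᵇ i σ) 0 B) (blocks σ (suc j) Cs)))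
      (trans (cong (λ q → Registers.r₁ (proj₁ (transduce (on-tracks check-canonical) q (blocks σ (suc j) Cs)))) (canonical-block σ (j ≡ᵇ i σ) 0 B si ok false false))
             (canonical-blocks σ Cs (suc j) _ _))

  canonical-result : ∀ σ → Registers.r₁ (pass-state cCanon (render σ)) ≡ canonical-from (circuit σ) (i σ) 0 bases false true
  canonical-result σ = trans (cong Registers.r₁ (pass-state-blocks check-canonical _ σ)) (canonical-blocks σ bases 0 false true)


module Loops (n : ℕ) (B0 : Vec Bool n) (Bs : List (Subset n)) where

  open import Data.Product using (proj₁)
  open import Data.Sum using (_⊎_; inj₁; inj₂)
  open import Data.Maybe using (Maybe; just; nothing)
  open import Data.Nat.Properties
  open import Data.Vec using (toList)
  open import Data.List.Properties using (++-assoc; ++-identityʳ; concatMap-++)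
  open import Relation.Binary.PropositionalEquality
  open import Data.Nat.Tactic.RingSolver using (solve-∀)
  open Program
  open Execution n B0 Bs public
  open PassResults n B0 Bs hiding (bases) public

  Bi : ℕ → Subset n
  Bi j = nth bases j

  Agree : ∀ {l} → Vec Bool l → Vec Bool l → ℕ → Set
  Agree V W k = ∀ c → c < k → at V c ≡ at W c

  at-ext : ∀ {l} (V W : Vec Bool l) → Agree V W l → V ≡ W
  at-ext [] [] h = refl
  at-ext (a ∷ V) (b ∷ W) h = cong₂ _∷_ (h 0 (s≤s z≤n)) (at-ext V W (λ c lt → h (suc c) (s≤s lt)))

  agree-step : ∀ (V W : Vec Bool n) k v → k < n → v ≡ at W k → Agree V W k → Agree (setAt k v V) W (suc k)
  agree-step V W k v kl hv ag c lt = trans (at-setAt k v V c (≤-trans lt kl)) (agree-at (m<1+n⇒m<n∨m≡n lt))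
    where
    agree-at : c < k ⊎ c ≡ k → (if c ≡ᵇ k then v else at V c) ≡ at W c
    agree-at (inj₁ c<k) rewrite ≡ᵇ-≢ c k (λ c≡k → <-irrefl c≡k c<k) = ag c c<k
    agree-at (inj₂ refl) rewrite ≡ᵇ-refl c = hv

  Run-cost : ∀ {p p' c σ st σ'} → p ≡ p' → Run p c σ st σ' → Run p' c σ st σ'
  Run-cost refl r = r

  +0≡⇒≡ : ∀ {N} k → k + 0 ≡ N → k ≡ N
  +0≡⇒≡ k h = trans (sym (+-identityʳ k)) h

  +suc≡⇒suc+≡ : ∀ {N} k d → k + suc d ≡ N → suc k + d ≡ N
  +suc≡⇒suc+≡ k d h = trans (sym (+-suc k d)) h

  test-cursor-result : Cursor → Store → Bool
  test-cursor-result X σ = Registers.r₀ (proj₁ (transduce (on-tracks (test-cursor X)) (regs false false false false) (render σ)))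

  branch-exit : ∀ X σ (x y : Phase) → cursor X σ ≡ n → just (if test-cursor-result X σ then x else y) ≡ just x
  branch-exit X σ x y X≡n rewrite test-result X σ | X≡n | ≡ᵇ-refl n = refl

  branch-stay : ∀ X σ (x y : Phase) → cursor X σ < n → just (if test-cursor-result X σ then x else y) ≡ just y
  branch-stay X σ x y X<n rewrite test-result X σ | ≡ᵇ-≢ n (cursor X σ) (λ n≡X → <-irrefl (sym n≡X) X<n) = refl

  branch-on : ∀ {b b'} (x y : Phase) → b ≡ b' → just (if b then x else y) ≡ just (if b' then x else y)
  branch-on x y = cong (λ b → just (if b then x else y))

  copy-basis-loop : ∀ d σ → k σ + d ≡ n → i σ < m → Agree (basis σ) (Bi (i σ)) (k σ) →
                    Run (4 * d + 1) cTestKB σ (entering cResetE) (record σ { k = n ; basis = Bi (i σ) })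
  copy-basis-loop zero σ h il ag = Run-store σ≡ (pass-to cTestKB σ cResetE (λ ()) (branch-exit cK σ cResetE cBfind k≡n))
    where
    k≡n = +0≡⇒≡ (k σ) h
    σ≡ : σ ≡ record σ { k = n ; basis = Bi (i σ) }
    σ≡ = cong₂ (λ a b → store (i σ) (e σ) (f σ) a b (circuit σ) (out σ)) k≡n
           (at-ext (basis σ) (Bi (i σ)) (subst (Agree (basis σ) (Bi (i σ))) k≡n ag))
  copy-basis-loop (suc d) σ h il ag = Run-cost (arith d) (test ⨾ read ⨾ write ⨾ advance ⨾ rest)
    where
    kl = +suc≡⇒< (k σ) d h
    v = Registers.r₀ (pass-state cBfind (render σ))
    test = pass-to cTestKB σ cBfind (λ ()) (branch-stay cK σ cResetE cBfind kl)
    read = pass-to cBfind σ (cBwrite v) (λ ()) refl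
    write = pass-to (cBwrite v) σ cAdvKB (λ ()) refl
    advance = pass-to cAdvKB (basis-set v σ) cTestKB (λ ()) refl
    rest = copy-basis-loop d _ (+suc≡⇒suc+≡ (k σ) d h) il (agree-step (basis σ) (Bi (i σ)) (k σ) v kl (basis-read-result σ il kl) ag)
    arith : ∀ d → 1 + (1 + (1 + (1 + (4 * d + 1)))) ≡ 4 * suc d + 1
    arith = solve-∀

  -- Column c of the fundamental circuit of e in V: c = e, or c ∈ V and V - c + e is listed as a basis.
  fundamental-bit : Vec Bool n → ℕ → ℕ → Bool
  fundamental-bit V e c = (c ≡ᵇ e) ∨ (at V c ∧ exchange-listed V e c false bases)

  tabulate-from : (ℕ → Bool) → ℕ → (l : ℕ) → Vec Bool l
  tabulate-from g c zero = []
  tabulate-from g c (suc l) = g c ∷ tabulate-from g (suc c) l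

  at-tabulate-from : ∀ g c l d → d < l → at (tabulate-from g c l) d ≡ g (c + d)
  at-tabulate-from g c (suc l) zero lt = cong g (sym (+-identityʳ c))
  at-tabulate-from g c (suc l) (suc d) (s≤s lt) = trans (at-tabulate-from g (suc c) l d lt) (cong g (sym (+-suc c d)))

  fundamental : Vec Bool n → ℕ → Vec Bool n
  fundamental V e = tabulate-from (fundamental-bit V e) 0 n

  circuit-loop : ∀ d σ → f σ + d ≡ n → Agree (circuit σ) (fundamental (basis σ) (e σ)) (f σ) →
                 Run (4 * d + 1) cTestF σ (entering cCanon) (record σ { f = n ; circuit = fundamental (basis σ) (e σ) })
  circuit-loop zero σ h ag = Run-store σ≡ (pass-to cTestF σ cCanon (λ ()) (branch-exit cF σ cCanon cSfind f≡n))
    where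
    f≡n = +0≡⇒≡ (f σ) h
    σ≡ : σ ≡ record σ { f = n ; circuit = fundamental (basis σ) (e σ) }
    σ≡ = cong₂ (λ a b → store (i σ) (e σ) a (k σ) (basis σ) b (out σ)) f≡n
           (at-ext (circuit σ) _ (subst (Agree (circuit σ) (fundamental (basis σ) (e σ))) f≡n ag))
  circuit-loop (suc d) σ h ag = Run-cost (arith d) (test ⨾ search ⨾ write ⨾ advance ⨾ rest)
    where
    fl = +suc≡⇒< (f σ) d h
    v = exchange-bit (pass-state cSfind (render σ))
    test = pass-to cTestF σ cSfind (λ ()) (branch-stay cF σ cCanon cSfind fl)
    search = pass-to cSfind σ (cSwrite v) (λ ()) refl
    write = pass-to (cSwrite v) σ cAdvF (λ ()) refl
    advance = pass-to cAdvF (circuit-set v σ) cTestF (λ ()) refl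
    v≡ : v ≡ at (fundamental (basis σ) (e σ)) (f σ)
    v≡ = trans (exchange-bit-result σ fl) (sym (at-tabulate-from (fundamental-bit (basis σ) (e σ)) 0 n (f σ) fl))
    rest = circuit-loop d _ (+suc≡⇒suc+≡ (f σ) d h) (agree-step (circuit σ) (fundamental (basis σ) (e σ)) (f σ) v fl v≡ ag)
    arith : ∀ d → 1 + (1 + (1 + (1 + (4 * d + 1)))) ≡ 4 * suc d + 1
    arith = solve-∀

  column-bits : ∀ {l} → Vec Bool l → ℕ → ℕ → List (Maybe Bool)
  column-bits S c zero = []
  column-bits S c (suc d) = just (at S c) ∷ column-bits S (suc c) d

  column-bits-all : ∀ {l} (V : Vec Bool l) → column-bits V 0 l ++ nothing ∷ [] ≡ setBits V
  column-bits-all V = cong (_++ nothing ∷ []) (from-0 V)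
    where
    shift : ∀ {l} b (V : Vec Bool l) c d → column-bits (b ∷ V) (suc c) d ≡ column-bits V c d
    shift b V c zero = refl
    shift b V c (suc d) = cong (just (at V c) ∷_) (shift b V (suc c) d)
    from-0 : ∀ {l} (V : Vec Bool l) → column-bits V 0 l ≡ map just (toList V)
    from-0 [] = refl
    from-0 (b ∷ V) = cong (just b ∷_) (trans (shift b V 0 _) (from-0 V))

  print-loop : ∀ d σ → k σ + d ≡ n →
               Run (3 * d + 2) cTestKO σ (entering cAdvE) (record σ { k = n ; out = out σ ++ column-bits (circuit σ) (k σ) d ++ nothing ∷ [] })
  print-loop zero σ h = Run-store σ≡ (test ⨾ separator)
    where
    test = pass-to cTestKO σ cOutSep (λ ()) (branch-exit cK σ cOutSep cOutBit (+0≡⇒≡ (k σ) h))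
    separator = pass-to cOutSep σ cAdvE (λ ()) refl
    σ≡ : record σ { out = out σ ++ nothing ∷ [] } ≡ record σ { k = n ; out = out σ ++ nothing ∷ [] }
    σ≡ = cong (λ a → store (i σ) (e σ) (f σ) a (basis σ) (circuit σ) (out σ ++ nothing ∷ [])) (+0≡⇒≡ (k σ) h)
  print-loop (suc d) σ h = Run-store σ≡ (Run-cost (arith d) (test ⨾ print ⨾ advance ⨾ rest))
    where
    kl = +suc≡⇒< (k σ) d h
    σ₁ = record σ { out = out σ ++ just (printed-bit σ) ∷ [] }
    test = pass-to cTestKO σ cOutBit (λ ()) (branch-stay cK σ cOutSep cOutBit kl)
    print = pass-to cOutBit σ cAdvKO (λ ()) refl
    advance = pass-to cAdvKO σ₁ cTestKO (λ ()) refl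
    rest = print-loop d (set-cursor cK (suc (k σ)) σ₁) (+suc≡⇒suc+≡ (k σ) d h)
    arith : ∀ d → 1 + (1 + (1 + (3 * d + 2))) ≡ 3 * suc d + 2
    arith = solve-∀
    σ≡ : record σ₁ { k = n ; out = out σ₁ ++ column-bits (circuit σ) (suc (k σ)) d ++ nothing ∷ [] } ≡
         record σ { k = n ; out = out σ ++ column-bits (circuit σ) (k σ) (suc d) ++ nothing ∷ [] }
    σ≡ = cong (store (i σ) (e σ) (f σ) n (basis σ) (circuit σ))
           (trans (++-assoc (out σ) (just (printed-bit σ) ∷ []) _)
                  (cong (λ b → out σ ++ just b ∷ column-bits (circuit σ) (suc (k σ)) d ++ nothing ∷ []) (printed-bit-result σ kl)))

  -- The fundamental circuit of e ∉ Bᵢ is printed when i is the first index with |C ─ Bᵢ| ≤ 1.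
  canonical : ℕ → ℕ → Bool
  canonical i e = canonical-from (fundamental (Bi i) e) i 0 bases false true

  printed-at : ℕ → ℕ → List (Subset n)
  printed-at i e = if at (Bi i) e then [] else (if canonical i e then fundamental (Bi i) e ∷ [] else [])

  printed-from : ℕ → ℕ → ℕ → List (Subset n)
  printed-from i e zero = []
  printed-from i e (suc d) = printed-at i e ++ printed-from i (suc e) d

  printed-bases : ℕ → ℕ → List (Subset n)
  printed-bases i zero = []
  printed-bases i (suc d) = printed-from i 0 n ++ printed-bases (suc i) d

  element-cost : ℕ
  element-cost = 7 * n + 9

  record ElementStep (σ : Store) : Set where
    constructor element-step-to
    field
      σ' : Store
      same-i : i σ' ≡ i σ
      next-e : e σ' ≡ suc (e σ)
      same-basis : basis σ' ≡ basis σ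
      printed : out σ' ≡ out σ ++ setsBits (printed-at (i σ) (e σ))
      runs : Run element-cost cTestE σ (entering cTestE) σ'

  module _ (σ : Store) (el : e σ < n) (basis≡ : basis σ ≡ Bi (i σ)) where

    private
      test = pass-to cTestE σ cTestBcE (λ ()) (branch-stay cE σ cAdvI cTestBcE el)

    element-in-basis : at (Bi (i σ)) (e σ) ≡ true → ElementStep σ
    element-in-basis e∈Bi = element-step-to _ refl refl refl printed-nothing
      (Run-weaken (≤-trans (s≤s (s≤s (s≤s (z≤n {6})))) (m≤n+m 9 (7 * n))) (test ⨾ read ⨾ advance))
      where
      read = pass-to cTestBcE σ cAdvE (λ ()) (branch-on cAdvE cResetF (trans (basis-bit-result σ el) (trans (cong (λ V → at V (e σ)) basis≡) e∈Bi)))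
      advance = pass-to cAdvE σ cTestE (λ ()) refl
      printed-nothing : out σ ≡ out σ ++ setsBits (printed-at (i σ) (e σ))
      printed-nothing rewrite e∈Bi = sym (++-identityʳ (out σ))

    private
      σ₁ = record σ { f = n ; circuit = fundamental (basis σ) (e σ) }

      build : at (Bi (i σ)) (e σ) ≡ false → Run (1 + (1 + (1 + (4 * n + 1)))) cTestE σ (entering cCanon) σ₁
      build e∉Bi = test ⨾ read ⨾ reset ⨾ circuit-loop n (set-cursor cF 0 σ) refl (λ c ())
        where
        read = pass-to cTestBcE σ cResetF (λ ()) (branch-on cAdvE cResetF (trans (basis-bit-result σ el) (trans (cong (λ V → at V (e σ)) basis≡) e∉Bi)))
        reset = pass-to cResetF σ cTestF (λ ()) refl

      canonical≡ : canonical-from (circuit σ₁) (i σ) 0 bases false true ≡ canonical (i σ) (e σ)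
      canonical≡ = cong (λ V → canonical-from (fundamental V (e σ)) (i σ) 0 bases false true) basis≡

    element-printed : at (Bi (i σ)) (e σ) ≡ false → canonical (i σ) (e σ) ≡ true → ElementStep σ
    element-printed e∉Bi can = element-step-to _ refl refl refl printed-circuit (Run-cost (arith n) (build e∉Bi ⨾ check ⨾ reset ⨾ print-loop n _ refl ⨾ advance))
      where
      check = pass-to cCanon σ₁ cResetKO (λ ()) (branch-on cResetKO cAdvE (trans (canonical-result σ₁) (trans canonical≡ can)))
      reset = pass-to cResetKO σ₁ cTestKO (λ ()) refl
      advance = pass-to cAdvE _ cTestE (λ ()) refl
      arith : ∀ n → 1 + (1 + (1 + (4 * n + 1))) + (1 + (1 + ((3 * n + 2) + 1))) ≡ 7 * n + 9
      arith = solve-∀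
      printed-circuit : out σ ++ column-bits (circuit σ₁) 0 n ++ nothing ∷ [] ≡ out σ ++ setsBits (printed-at (i σ) (e σ))
      printed-circuit rewrite e∉Bi | can | column-bits-all (circuit σ₁) | basis≡ = cong (out σ ++_) (sym (++-identityʳ _))

    element-skipped : at (Bi (i σ)) (e σ) ≡ false → canonical (i σ) (e σ) ≡ false → ElementStep σ
    element-skipped e∉Bi ¬can = element-step-to _ refl refl refl printed-nothing (Run-weaken bound (build e∉Bi ⨾ check ⨾ advance))
      where
      check = pass-to cCanon σ₁ cAdvE (λ ()) (branch-on cResetKO cAdvE (trans (canonical-result σ₁) (trans canonical≡ ¬can)))
      advance = pass-to cAdvE σ₁ cTestE (λ ()) refl
      arith : ∀ n → 1 + (1 + (1 + (4 * n + 1))) + (1 + 1) + (3 * n + 3) ≡ 7 * n + 9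
      arith = solve-∀
      bound : 1 + (1 + (1 + (4 * n + 1))) + (1 + 1) ≤ 7 * n + 9
      bound = subst (1 + (1 + (1 + (4 * n + 1))) + (1 + 1) ≤_) (arith n) (m≤m+n _ (3 * n + 3))
      printed-nothing : out σ ≡ out σ ++ setsBits (printed-at (i σ) (e σ))
      printed-nothing rewrite e∉Bi | ¬can = sym (++-identityʳ (out σ))

    element-step : ElementStep σ
    element-step with at (Bi (i σ)) (e σ) in e∈? | canonical (i σ) (e σ) in can?
    ... | true | _ = element-in-basis e∈?
    ... | false | true = element-printed e∈? can?
    ... | false | false = element-skipped e∈? can?

  record ElementLoop (σ : Store) (d : ℕ) : Set where
    constructor element-loop-to
    field
      σ' : Store
      same-i : i σ' ≡ i σ
      printed : out σ' ≡ out σ ++ setsBits (printed-from (i σ) (e σ) d)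
      runs : Run (d * element-cost + 1) cTestE σ (entering cAdvI) σ'

  element-loop : ∀ d σ → e σ + d ≡ n → basis σ ≡ Bi (i σ) → ElementLoop σ d
  element-loop zero σ h _ = element-loop-to σ refl (sym (++-identityʳ (out σ)))
    (pass-to cTestE σ cAdvI (λ ()) (branch-exit cE σ cAdvI cTestBcE (+0≡⇒≡ (e σ) h)))
  element-loop (suc d) σ h basis≡ with element-step σ (+suc≡⇒< (e σ) d h) basis≡
  ... | element-step-to σ₁ same-i₁ next-e same-basis printed₁ run₁
    with element-loop d σ₁ (trans (cong (_+ d) next-e) (+suc≡⇒suc+≡ (e σ) d h)) (trans same-basis (trans basis≡ (cong Bi (sym same-i₁))))
  ... | element-loop-to σ₂ same-i₂ printed₂ run₂ =
    element-loop-to σ₂ (trans same-i₂ same-i₁) printed (Run-cost (sym (+-assoc element-cost (d * element-cost) 1)) (run₁ ⨾ run₂))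
    where
    printed : out σ₂ ≡ out σ ++ setsBits (printed-from (i σ) (e σ) (suc d))
    printed = begin
      out σ₂                                                             ≡⟨ printed₂ ⟩
      out σ₁ ++ setsBits (printed-from (i σ₁) (e σ₁) d)                  ≡⟨ cong₂ (λ o j → o ++ setsBits (printed-from j (e σ₁) d)) printed₁ same-i₁ ⟩
      (out σ ++ setsBits (printed-at (i σ) (e σ))) ++ setsBits (printed-from (i σ) (e σ₁) d)
                                                                         ≡⟨ ++-assoc (out σ) _ _ ⟩
      out σ ++ setsBits (printed-at (i σ) (e σ)) ++ setsBits (printed-from (i σ) (e σ₁) d)
                                                                         ≡⟨ cong (λ x → out σ ++ setsBits (printed-at (i σ) (e σ)) ++ setsBits (printed-from (i σ) x d)) next-e ⟩
      out σ ++ setsBits (printed-at (i σ) (e σ)) ++ setsBits (printed-from (i σ) (suc (e σ)) d)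
                                                                         ≡⟨ cong (out σ ++_) (concatMap-++ setBits (printed-at (i σ) (e σ)) _) ⟨
      out σ ++ setsBits (printed-from (i σ) (e σ) (suc d))               ∎
      where open ≡-Reasoning

  basis-cost : ℕ
  basis-cost = n * element-cost + 4 * n + 5

  record BasisRound (σ : Store) : Set where
    constructor basis-round-to
    field
      σ' : Store
      same-i : i σ' ≡ i σ
      printed : out σ' ≡ out σ ++ setsBits (printed-from (i σ) 0 n)
      runs : Run (n * element-cost + 4 * n + 4) cResetKB σ (entering cAdvI) σ'

  basis-round : ∀ σ → i σ < m → BasisRound σ
  basis-round σ il with element-loop n (set-cursor cE 0 (record (set-cursor cK 0 σ) { k = n ; basis = Bi (i σ) })) refl refl
  ... | element-loop-to σ' same-i printed run = basis-round-to σ' same-i printed (Run-cost (arith n element-cost) (reset ⨾ copy ⨾ reset-e ⨾ run))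
    where
    reset = pass-to cResetKB σ cTestKB (λ ()) refl
    copy = copy-basis-loop n (set-cursor cK 0 σ) refl il (λ c ())
    reset-e = pass-to cResetE (record (set-cursor cK 0 σ) { k = n ; basis = Bi (i σ) }) cTestE (λ ()) refl
    arith : ∀ n E → 1 + (4 * n + 1 + (1 + (n * E + 1))) ≡ n * E + 4 * n + 4
    arith = solve-∀

  record BasisLoop (σ : Store) (d : ℕ) : Set where
    constructor basis-loop-to
    field
      σ' : Store
      printed : out σ' ≡ out σ ++ setsBits (printed-bases (i σ) (suc d))
      runs : Run (suc d * basis-cost) cResetKB σ seeking σ'

  basis-loop : ∀ d σ → i σ + suc d ≡ m → BasisLoop σ d
  basis-loop d σ h with basis-round σ (+suc≡⇒< (i σ) d h)
  ... | basis-round-to σ₁ same-i printed₁ run₁ = continue d h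
    where
    next-basis-state : Registers.r₁ (pass-state cAdvI (render σ₁)) ≡ in-range (suc (i σ)) 0 bases false
    next-basis-state = trans (advance-basis-result σ₁) (cong (λ j → in-range (suc j) 0 bases false) same-i)
    continue : ∀ d → i σ + suc d ≡ m → BasisLoop σ d
    continue zero h₀ = basis-loop-to (next-basis σ₁) printed (Run-cost (arith n element-cost) (run₁ ⨾ pass-end cAdvI σ₁ (λ ()) finish))
      where
      finish : pass-next cAdvI (render σ₁) ≡ nothing
      finish rewrite next-basis-state | in-range-miss (suc (i σ)) 0 bases false (≤-reflexive (trans (sym h₀) (+-comm (i σ) 1))) = refl
      arith : ∀ n E → n * E + 4 * n + 4 + 1 ≡ 1 * (n * E + 4 * n + 5)
      arith = solve-∀
      printed : out σ₁ ≡ out σ ++ setsBits (printed-bases (i σ) 1)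
      printed = trans printed₁ (cong (λ x → out σ ++ setsBits x) (sym (++-identityʳ (printed-from (i σ) 0 n))))
    continue (suc d) h₁ with basis-loop d (next-basis σ₁) (trans (cong (λ j → suc j + suc d) same-i) (trans (sym (+-suc (i σ) (suc d))) h₁))
    ... | basis-loop-to σ₂ printed₂ run₂ = basis-loop-to σ₂ printed (Run-cost cost (run₁ ⨾ pass-to cAdvI σ₁ cResetKB (λ ()) again ⨾ run₂))
      where
      again : pass-next cAdvI (render σ₁) ≡ just cResetKB
      again rewrite next-basis-state | in-range-hit (suc (i σ)) (suc (i σ)) 0 bases false refl
                                         (subst (suc (i σ) <_) h₁ (subst (suc (i σ) <_) (sym (+-suc (i σ) (suc d))) (s≤s (m<m+n (i σ) (s≤s z≤n))))) = refl
      cost : n * element-cost + 4 * n + 4 + (1 + suc d * basis-cost) ≡ suc (suc d) * basis-cost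
      cost = arith n element-cost (suc d * basis-cost)
        where
        arith : ∀ n E x → n * E + 4 * n + 4 + (1 + x) ≡ (n * E + 4 * n + 5) + x
        arith = solve-∀
      printed : out σ₂ ≡ out σ ++ setsBits (printed-bases (i σ) (suc (suc d)))
      printed = begin
        out σ₂                                                                  ≡⟨ printed₂ ⟩
        out σ₁ ++ setsBits (printed-bases (suc (i σ₁)) (suc d))                 ≡⟨ cong₂ (λ o j → o ++ setsBits (printed-bases (suc j) (suc d))) printed₁ same-i ⟩
        (out σ ++ setsBits (printed-from (i σ) 0 n)) ++ setsBits (printed-bases (suc (i σ)) (suc d))
                                                                                ≡⟨ ++-assoc (out σ) _ _ ⟩
        out σ ++ setsBits (printed-from (i σ) 0 n) ++ setsBits (printed-bases (suc (i σ)) (suc d))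
                                                                                ≡⟨ cong (out σ ++_) (concatMap-++ setBits (printed-from (i σ) 0 n) _) ⟨
        out σ ++ setsBits (printed-bases (i σ) (suc (suc d)))                   ∎
        where open ≡-Reasoning

module Canonicity (n : ℕ) (B0 : Vec Bool n) (Bs : List (Subset n)) where

  open import Data.Product using (_×_; _,_; proj₁; proj₂; Σ)
  open import Data.Sum using (_⊎_; inj₁; inj₂)
  open import Data.Nat.Properties
  open import Data.Empty using (⊥-elim)
  import Data.Bool.Properties
  open import Relation.Nullary using (yes; no)
  open import Data.Nat using (_≟_)
  open import Relation.Binary.PropositionalEquality
  open Program
  open Layout n (B0 ∷ Bs)
  open PassResults n B0 Bs

  ∨≡true⁻ : ∀ a b → a ∨ b ≡ true → a ≡ true ⊎ b ≡ true
  ∨≡true⁻ true b h = inj₁ refl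
  ∨≡true⁻ false b h = inj₂ h

  ∧≡true⁻ : ∀ a b → a ∧ b ≡ true → a ≡ true × b ≡ true
  ∧≡true⁻ true b h = refl , h

  ∨≡trueˡ : ∀ a b → a ≡ true → a ∨ b ≡ true
  ∨≡trueˡ .true b refl = refl

  ∨≡trueʳ : ∀ a b → b ≡ true → a ∨ b ≡ true
  ∨≡trueʳ true b h = refl
  ∨≡trueʳ false b h = h

  ∧≡true⁺ : ∀ a b → a ≡ true → b ≡ true → a ∧ b ≡ true
  ∧≡true⁺ .true .true refl refl = refl

  OutsideAt : Vec Bool n → ℕ → ∀ {l} → Vec Bool l → ℕ → Set
  OutsideAt S c B y = outside-at S (c + y) (at B y) ≡ true

  data TwoOutsideFrom (S : Vec Bool n) (c : ℕ) {l} (B : Vec Bool l) (c1 c2 : Bool) : Set where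
    counted-two : c2 ≡ true → TwoOutsideFrom S c B c1 c2
    counted-one : c1 ≡ true → (y : ℕ) → y < l → OutsideAt S c B y → TwoOutsideFrom S c B c1 c2
    found-two : (x y : ℕ) → x < y → y < l → OutsideAt S c B x → OutsideAt S c B y → TwoOutsideFrom S c B c1 c2

  OutsideAt-shift : ∀ S c b {l} (B : Vec Bool l) y → OutsideAt S (suc c) B y → OutsideAt S c (b ∷ B) (suc y)
  OutsideAt-shift S c b B y h = trans (cong (λ z → outside-at S z (at B y)) (+-suc c y)) h

  OutsideAt-0 : ∀ S c b {l} (B : Vec Bool l) → outside-at S c b ≡ true → OutsideAt S c (b ∷ B) 0
  OutsideAt-0 S c b B h = trans (cong (λ z → outside-at S z b) (+-identityʳ c)) h

  OutsideAt-0⁻ : ∀ S c b {l} (B : Vec Bool l) → OutsideAt S c (b ∷ B) 0 → outside-at S c b ≡ true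
  OutsideAt-0⁻ S c b B h = trans (cong (λ z → outside-at S z b) (sym (+-identityʳ c))) h

  OutsideAt-unshift : ∀ S c b {l} (B : Vec Bool l) y → OutsideAt S c (b ∷ B) (suc y) → OutsideAt S (suc c) B y
  OutsideAt-unshift S c b B y h = trans (cong (λ z → outside-at S z (at B y)) (sym (+-suc c y))) h

  two-outside-from-sound : ∀ S c {l} (B : Vec Bool l) c1 c2 → two-outside-from S c B c1 c2 ≡ true → TwoOutsideFrom S c B c1 c2
  two-outside-from-sound S c [] c1 c2 h = counted-two h
  two-outside-from-sound S c (b ∷ B) c1 c2 h with two-outside-from-sound S (suc c) B (c1 ∨ outside-at S c b) (c2 ∨ (c1 ∧ outside-at S c b)) h
  ... | counted-two h2 with ∨≡true⁻ c2 _ h2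
  ...   | inj₁ h3 = counted-two h3
  ...   | inj₂ h3 = counted-one (proj₁ (∧≡true⁻ c1 _ h3)) 0 (s≤s z≤n) (OutsideAt-0 S c b B (proj₂ (∧≡true⁻ c1 _ h3)))
  two-outside-from-sound S c (b ∷ B) c1 c2 h | counted-one h1 y yl py with ∨≡true⁻ c1 _ h1
  ...   | inj₁ h3 = counted-one h3 (suc y) (s≤s yl) (OutsideAt-shift S c b B y py)
  ...   | inj₂ h3 = found-two 0 (suc y) (s≤s z≤n) (s≤s yl) (OutsideAt-0 S c b B h3) (OutsideAt-shift S c b B y py)
  two-outside-from-sound S c (b ∷ B) c1 c2 h | found-two x y xy yl px py = found-two (suc x) (suc y) (s≤s xy) (s≤s yl) (OutsideAt-shift S c b B x px) (OutsideAt-shift S c b B y py)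

  two-outside-from-counted : ∀ S c {l} (B : Vec Bool l) c1 → two-outside-from S c B c1 true ≡ true
  two-outside-from-counted S c [] c1 = refl
  two-outside-from-counted S c (b ∷ B) c1 = two-outside-from-counted S (suc c) B _

  two-outside-from-complete : ∀ S c {l} (B : Vec Bool l) c1 c2 → TwoOutsideFrom S c B c1 c2 → two-outside-from S c B c1 c2 ≡ true
  two-outside-from-complete S c [] c1 c2 (counted-two h) = h
  two-outside-from-complete S c [] c1 c2 (counted-one _ y () _)
  two-outside-from-complete S c [] c1 c2 (found-two x y _ () _ _)
  two-outside-from-complete S c (b ∷ B) c1 .true (counted-two refl) = two-outside-from-counted S c (b ∷ B) c1
  two-outside-from-complete S c (b ∷ B) .true c2 (counted-one refl zero yl py) =
    two-outside-from-complete S (suc c) B _ _ (counted-two (∨≡trueʳ c2 _ (OutsideAt-0⁻ S c b B py)))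
  two-outside-from-complete S c (b ∷ B) .true c2 (counted-one refl (suc y) (s≤s yl) py) =
    two-outside-from-complete S (suc c) B _ _ (counted-one refl y yl (OutsideAt-unshift S c b B y py))
  two-outside-from-complete S c (b ∷ B) c1 c2 (found-two zero (suc y) xy (s≤s yl) px py) =
    two-outside-from-complete S (suc c) B _ _ (counted-one (∨≡trueʳ c1 _ (OutsideAt-0⁻ S c b B px)) y yl (OutsideAt-unshift S c b B y py))
  two-outside-from-complete S c (b ∷ B) c1 c2 (found-two (suc x) (suc y) (s≤s xy) (s≤s yl) px py) =
    two-outside-from-complete S (suc c) B _ _ (found-two x y xy yl (OutsideAt-unshift S c b B x px) (OutsideAt-unshift S c b B y py))

  two-outside : Vec Bool n → Vec Bool n → Bool
  two-outside S B = two-outside-from S 0 B false false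

  OutsideAtColumn : Vec Bool n → Vec Bool n → ℕ → Set
  OutsideAtColumn S B y = outside-at S y (at B y) ≡ true

  two-outside-sound : ∀ S B → two-outside S B ≡ true → Σ ℕ λ x → Σ ℕ λ y → x < y × y < n × OutsideAtColumn S B x × OutsideAtColumn S B y
  two-outside-sound S B h with two-outside-from-sound S 0 B false false h
  ... | counted-two ()
  ... | counted-one () _ _ _
  ... | found-two x y xy yl px py = x , y , xy , yl , px , py

  two-outside-complete : ∀ S B x y → x < y → y < n → OutsideAtColumn S B x → OutsideAtColumn S B y → two-outside S B ≡ true
  two-outside-complete S B x y xy yl px py = two-outside-from-complete S 0 B false false (found-two x y xy yl px py)

  canonical-from-seen : ∀ S i j Cs ok → canonical-from S i j Cs true ok ≡ ok
  canonical-from-seen S i j [] ok = refl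
  canonical-from-seen S i j (B ∷ Cs) ok = trans (canonical-from-seen S i (suc j) Cs _) (Data.Bool.Properties.∧-identityʳ ok)

  canonical-from-sound : ∀ S i j Cs ok → j ≤ i → i < j + length Cs → canonical-from S i j Cs false ok ≡ true →
               ok ≡ true × (∀ d → j + d < i → two-outside S (nth Cs d) ≡ true)
  canonical-from-sound S i j [] ok ji il h = ⊥-elim (<-irrefl refl (<-≤-trans il (≤-trans (≤-reflexive (+-identityʳ j)) ji)))
  canonical-from-sound S i j (B ∷ Cs) ok ji il h with i ≟ j
  ... | yes refl rewrite ≡ᵇ-refl i | canonical-from-seen S i (suc i) Cs (ok ∧ true) =
        proj₁ (∧≡true⁻ ok true h) , λ d lt → ⊥-elim (<-irrefl refl (≤-trans (s≤s (m≤m+n i d)) lt))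
  ... | no ne rewrite ≡ᵇ-≢ j i (λ e → ne (sym e)) with canonical-from-sound S i (suc j) Cs (ok ∧ two-outside S B) (≤∧≢⇒< ji (λ e → ne (sym e))) (subst (i <_) (+-suc j (length Cs)) il) h
  ...   | okt , rest = proj₁ (∧≡true⁻ ok _ okt) , earlier-two
    where
    earlier-two : ∀ d → j + d < i → two-outside S (nth (B ∷ Cs) d) ≡ true
    earlier-two zero lt = proj₂ (∧≡true⁻ ok _ okt)
    earlier-two (suc d) lt = rest d (subst (_< i) (+-suc j d) lt)

  canonical-from-complete : ∀ S i j Cs ok → j ≤ i → i < j + length Cs → ok ≡ true → (∀ d → j + d < i → two-outside S (nth Cs d) ≡ true) →
                  canonical-from S i j Cs false ok ≡ true
  canonical-from-complete S i j [] ok ji il okt h = ⊥-elim (<-irrefl refl (<-≤-trans il (≤-trans (≤-reflexive (+-identityʳ j)) ji)))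
  canonical-from-complete S i j (B ∷ Cs) ok ji il okt h with i ≟ j
  ... | yes refl rewrite ≡ᵇ-refl i | canonical-from-seen S i (suc i) Cs (ok ∧ true) = trans (Data.Bool.Properties.∧-identityʳ ok) okt
  ... | no ne rewrite ≡ᵇ-≢ j i (λ e → ne (sym e)) =
        canonical-from-complete S i (suc j) Cs (ok ∧ two-outside S B) (≤∧≢⇒< ji (λ e → ne (sym e))) (subst (i <_) (+-suc j (length Cs)) il)
          (∧≡true⁺ ok (two-outside S B) okt (h 0 (subst (_< i) (sym (+-identityʳ j)) (≤∧≢⇒< ji (λ e → ne (sym e))))))
          (λ d lt → h (suc d) (subst (_< i) (sym (+-suc j d)) lt))


module Correctness (n : ℕ) (B0 : Vec Bool n) (Bs : List (Subset n)) (M : Matroid n)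
             (enum : Enumerates (Matroid.IsBase M) (B0 ∷ Bs)) where

  open import Data.Fin using (Fin; toℕ; fromℕ<)
  open import Data.Fin.Properties using (toℕ-injective; toℕ<n; fromℕ<-toℕ; toℕ-fromℕ<)
  import Data.Fin.Subset as FS
  open import Data.Product using (_×_; _,_; proj₁; proj₂; Σ)
  open import Data.Sum using (_⊎_; inj₁; inj₂)
  open import Data.Nat.Properties
  open import Data.Empty using (⊥; ⊥-elim)
  open import Relation.Binary.PropositionalEquality
  open import Relation.Nullary using (¬_; yes; no)
  open import Data.Vec.Properties using ([]=⇒lookup; lookup⇒[]=)
  import Data.List.Membership.Propositional as L
  open import Data.List.Relation.Unary.Any using (here; there)
  open import Function.Bundles using (Equivalence; mk⇔)
  open import Data.List.Relation.Unary.Unique.Propositional using (Unique)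
  import Data.List.Relation.Unary.Unique.Propositional.Properties as UP
  open import Data.List.Relation.Unary.AllPairs using ([]; _∷_)
  open import Data.List.Relation.Unary.All using ([]; _∷_)
  open import Data.List.Membership.Propositional.Properties using (∈-++⁻; ∈-++⁺ˡ; ∈-++⁺ʳ)
  open import Data.Fin.Properties using (any?) renaming (_≟_ to _≟F_)
  open import Data.Fin.Subset.Properties using (_∈?_; x∈p⇒p-x⊂p; x∈p∧x≢y⇒x∈p-y)
  open import Relation.Nullary.Decidable using (_×-dec_; ¬?)
  open import Relation.Binary.Definitions using (tri<; tri≈; tri>)
  open Program
  open Loops n B0 Bs
  open Canonicity n B0 Bs using (∨≡true⁻; ∧≡true⁻; ∨≡trueˡ; ∨≡trueʳ; ∧≡true⁺; two-outside; two-outside-sound; two-outside-complete; OutsideAtColumn; canonical-from-sound; canonical-from-complete)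
  open FundamentalCircuit
  open Matroid M

  listed⇒base : ∀ {X} → X L.∈ bases → IsBase X
  listed⇒base h = Equivalence.to (proj₂ enum _) h

  base⇒listed : ∀ {X} → IsBase X → X L.∈ bases
  base⇒listed h = Equivalence.from (proj₂ enum _) h

  at-lookup : ∀ {l} (V : Vec Bool l) x → at V (toℕ x) ≡ Data.Vec.lookup V x
  at-lookup (b ∷ V) Fin.zero = refl
  at-lookup (b ∷ V) (Fin.suc x) = at-lookup V x

  ∈⇒at : ∀ {x} {V : Subset n} → x FS.∈ V → at V (toℕ x) ≡ true
  ∈⇒at {x} {V} h = trans (at-lookup V x) ([]=⇒lookup h)

  at⇒∈ : ∀ {x} {V : Subset n} → at V (toℕ x) ≡ true → x FS.∈ V
  at⇒∈ {x} {V} h = lookup⇒[]= x V (trans (sym (at-lookup V x)) h)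

  nth-∈ : ∀ (Cs : List (Subset n)) i → i < length Cs → nth Cs i L.∈ Cs
  nth-∈ (B ∷ Cs) zero _ = here refl
  nth-∈ (B ∷ Cs) (suc i) (s≤s lt) = there (nth-∈ Cs i lt)

  Bi-isBase : ∀ i → i < m → IsBase (Bi i)
  Bi-isBase i lt = listed⇒base (nth-∈ bases i lt)

  eqbit-sound : ∀ b x → eqbit b x ≡ true → b ≡ x
  eqbit-sound true true _ = refl
  eqbit-sound false false _ = refl

  eqbit-complete : ∀ b → eqbit b b ≡ true
  eqbit-complete true = refl
  eqbit-complete false = refl

  block-is-exchange-sound : ∀ V e f c {l} (B : Vec Bool l) a → block-is-exchange V e f c B a ≡ true → a ≡ true × (∀ y → y < l → at B y ≡ exchange-column V e f (c + y))
  block-is-exchange-sound V e f c [] a h = h , λ y ()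
  block-is-exchange-sound V e f c (b ∷ B) a h with block-is-exchange-sound V e f (suc c) B _ h
  ... | a∧b≡true , rest = proj₁ (∧≡true⁻ a _ a∧b≡true) , columns
    where
    columns : ∀ y → y < suc _ → at (b ∷ B) y ≡ exchange-column V e f (c + y)
    columns zero _ = trans (eqbit-sound b _ (proj₂ (∧≡true⁻ a _ a∧b≡true))) (cong (exchange-column V e f) (sym (+-identityʳ c)))
    columns (suc y) (s≤s lt) = trans (rest y lt) (cong (exchange-column V e f) (sym (+-suc c y)))

  block-is-exchange-complete : ∀ V e f c {l} (B : Vec Bool l) a → a ≡ true → (∀ y → y < l → at B y ≡ exchange-column V e f (c + y)) → block-is-exchange V e f c B a ≡ true
  block-is-exchange-complete V e f c [] a h1 h2 = h1
  block-is-exchange-complete V e f c (b ∷ B) a h1 h2 =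
    block-is-exchange-complete V e f (suc c) B _ (∧≡true⁺ a _ h1 (subst (λ z → eqbit b z ≡ true) hb (eqbit-complete b)))
      (λ y lt → trans (h2 (suc y) (s≤s lt)) (cong (exchange-column V e f) (+-suc c y)))
    where
    hb : b ≡ exchange-column V e f c
    hb = trans (h2 0 (s≤s z≤n)) (cong (exchange-column V e f) (+-identityʳ c))

  exchange-listed-sound : ∀ V e f a (Cs : List (Subset n)) → exchange-listed V e f a Cs ≡ true → a ≡ true ⊎ Σ (Subset n) λ B → B L.∈ Cs × block-is-exchange V e f 0 B true ≡ true
  exchange-listed-sound V e f a [] h = inj₁ h
  exchange-listed-sound V e f a (B ∷ Cs) h with exchange-listed-sound V e f _ Cs h
  ... | inj₂ (B' , mem , h') = inj₂ (B' , there mem , h')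
  ... | inj₁ h1 with ∨≡true⁻ a _ h1
  ...   | inj₁ h2 = inj₁ h2
  ...   | inj₂ h2 = inj₂ (B , here refl , h2)

  exchange-listed-true : ∀ V e f (Cs : List (Subset n)) → exchange-listed V e f true Cs ≡ true
  exchange-listed-true V e f [] = refl
  exchange-listed-true V e f (B ∷ Cs) = exchange-listed-true V e f Cs

  exchange-listed-complete : ∀ V e f a (Cs : List (Subset n)) B → B L.∈ Cs → block-is-exchange V e f 0 B true ≡ true → exchange-listed V e f a Cs ≡ true
  exchange-listed-complete V e f a (B ∷ Cs) .B (here refl) h = trans (cong (λ z → exchange-listed V e f z Cs) (∨≡trueʳ a _ h)) (exchange-listed-true V e f Cs)
  exchange-listed-complete V e f a (C ∷ Cs) B (there mem) h = exchange-listed-complete V e f _ Cs B mem h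

  exchange-vec : Vec Bool n → ℕ → ℕ → Vec Bool n
  exchange-vec V e f = tabulate-from (exchange-column V e f) 0 n

  exchange-vec-unique : ∀ V e f B → block-is-exchange V e f 0 B true ≡ true → B ≡ exchange-vec V e f
  exchange-vec-unique V e f B h = at-ext B (exchange-vec V e f) λ y lt → trans (proj₂ (block-is-exchange-sound V e f 0 B true h) y lt) (sym (at-tabulate-from (exchange-column V e f) 0 n y lt))

  exchange-vec-matches : ∀ V e f → block-is-exchange V e f 0 (exchange-vec V e f) true ≡ true
  exchange-vec-matches V e f = block-is-exchange-complete V e f 0 (exchange-vec V e f) true refl (λ y lt → at-tabulate-from (exchange-column V e f) 0 n y lt)

  ≡ᵇ⇒≡fromℕ : ∀ (x : Fin n) e (eL : e < n) → (toℕ x ≡ᵇ e) ≡ true → x ≡ fromℕ< eL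
  ≡ᵇ⇒≡fromℕ x e eL h = toℕ-injective (trans (≡ᵇ-true⇒≡ (toℕ x) e h) (sym (toℕ-fromℕ< eL)))

  ≡fromℕ⇒≡ᵇ : ∀ (x : Fin n) e (eL : e < n) → x ≡ fromℕ< eL → (toℕ x ≡ᵇ e) ≡ true
  ≡fromℕ⇒≡ᵇ x e eL h = trans (cong (λ z → toℕ z ≡ᵇ e) h) (trans (cong (_≡ᵇ e) (toℕ-fromℕ< eL)) (≡ᵇ-refl e))

  not-T : ∀ b → not b ≡ true → b ≡ false
  not-T false _ = refl

  Tv-exchange : ∀ V e f (eL : e < n) (fl : f < n) → exchange-vec V e f ≡ exchange V (fromℕ< fl) (fromℕ< eL)
  Tv-exchange V e f eL fl = Data.Fin.Subset.Properties.⊆-antisym vec⊆exchange exchange⊆vec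
    where
    open import Data.Fin.Subset.Properties
    atT : ∀ (x : Fin n) → at (exchange-vec V e f) (toℕ x) ≡ exchange-column V e f (toℕ x)
    atT x = at-tabulate-from (exchange-column V e f) 0 n (toℕ x) (toℕ<n x)
    vec⊆exchange : exchange-vec V e f FS.⊆ exchange V (fromℕ< fl) (fromℕ< eL)
    vec⊆exchange {x} h with ∨≡true⁻ (toℕ x ≡ᵇ e) _ (trans (sym (atT x)) (∈⇒at h))
    ... | inj₁ h1 = subst (FS._∈ exchange V (fromℕ< fl) (fromℕ< eL)) (sym (≡ᵇ⇒≡fromℕ x e eL h1)) new∈exchange
    ... | inj₂ h2 = ∈-exchange (at⇒∈ (proj₁ (∧≡true⁻ _ _ h2))) (λ xf → eqb-false (not-T _ (proj₂ (∧≡true⁻ _ _ h2))) (≡fromℕ⇒≡ᵇ x f fl xf))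
      where
      eqb-false : ∀ {b} → b ≡ false → b ≡ true → ⊥
      eqb-false refl ()
    exchange⊆vec : exchange V (fromℕ< fl) (fromℕ< eL) FS.⊆ exchange-vec V e f
    exchange⊆vec {x} h = at⇒∈ (trans (atT x) (column-true (∈-exchange⁻ {B = V} {x = fromℕ< fl} {y = fromℕ< eL} h)))
      where
      column-true : (x FS.∈ V × ¬ (x ≡ fromℕ< fl)) ⊎ x ≡ fromℕ< eL → exchange-column V e f (toℕ x) ≡ true
      column-true (inj₂ xe) = ∨≡trueˡ _ _ (≡fromℕ⇒≡ᵇ x e eL xe)
      column-true (inj₁ (xV , xnf)) = ∨≡trueʳ _ _ (∧≡true⁺ _ _ (∈⇒at xV) (cong not (≡ᵇ-≢ (toℕ x) f (λ ef → xnf (toℕ-injective (trans ef (sym (toℕ-fromℕ< fl))))))))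

  exchange-listed⇒base : ∀ V e f (eL : e < n) (fl : f < n) → exchange-listed V e f false bases ≡ true → IsBase (exchange V (fromℕ< fl) (fromℕ< eL))
  exchange-listed⇒base V e f eL fl h with exchange-listed-sound V e f false bases h
  ... | inj₁ ()
  ... | inj₂ (B , mem , h') = listed⇒base (subst (L._∈ bases) (trans (exchange-vec-unique V e f B h') (Tv-exchange V e f eL fl)) mem)

  base⇒exchange-listed : ∀ V e f (eL : e < n) (fl : f < n) → IsBase (exchange V (fromℕ< fl) (fromℕ< eL)) → exchange-listed V e f false bases ≡ true
  base⇒exchange-listed V e f eL fl h = exchange-listed-complete V e f false bases (exchange-vec V e f) (subst (L._∈ bases) (sym (Tv-exchange V e f eL fl)) (base⇒listed h)) (exchange-vec-matches V e f)

  fundamental-isFundamental : ∀ V e (eL : e < n) → IsFundamentalCircuit M V (fromℕ< eL) (fundamental V e)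
  fundamental-isFundamental V e eL x = mk⇔ to from
    where
    atS : at (fundamental V e) (toℕ x) ≡ fundamental-bit V e (toℕ x)
    atS = at-tabulate-from (fundamental-bit V e) 0 n (toℕ x) (toℕ<n x)
    fx : fromℕ< (toℕ<n x) ≡ x
    fx = fromℕ<-toℕ x (toℕ<n x)
    to : x FS.∈ fundamental V e → InFundamental M V (fromℕ< eL) x
    to h with ∨≡true⁻ (toℕ x ≡ᵇ e) _ (trans (sym atS) (∈⇒at h))
    ... | inj₁ h1 = inj₁ (≡ᵇ⇒≡fromℕ x e eL h1)
    ... | inj₂ h2 = inj₂ (at⇒∈ (proj₁ (∧≡true⁻ _ _ h2)) ,
                          subst (λ z → IsBase (exchange V z (fromℕ< eL))) fx (exchange-listed⇒base V e (toℕ x) eL (toℕ<n x) (proj₂ (∧≡true⁻ _ _ h2))))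
    from : InFundamental M V (fromℕ< eL) x → x FS.∈ fundamental V e
    from (inj₁ xe) = at⇒∈ (trans atS (∨≡trueˡ _ _ (≡fromℕ⇒≡ᵇ x e eL xe)))
    from (inj₂ (xV , hb)) = at⇒∈ (trans atS (∨≡trueʳ _ _ (∧≡true⁺ _ _ (∈⇒at xV)
                              (base⇒exchange-listed V e (toℕ x) eL (toℕ<n x) (subst (λ z → IsBase (exchange V z (fromℕ< eL))) (sym fx) hb)))))

  Prints : ℕ → ℕ → Set
  Prints i e = at (Bi i) e ≡ false × canonical i e ≡ true

  ∈-printed-at : ∀ {X} i e → X L.∈ printed-at i e → Prints i e × X ≡ fundamental (Bi i) e
  ∈-printed-at i e X∈ with at (Bi i) e | canonical i e
  ∈-printed-at i e (here X≡) | false | true = (refl , refl) , X≡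

  printed-at-∈ : ∀ i e → Prints i e → fundamental (Bi i) e L.∈ printed-at i e
  printed-at-∈ i e (e∉ , can) rewrite e∉ | can = here refl

  printed-at-unique : ∀ i e → Unique (printed-at i e)
  printed-at-unique i e with at (Bi i) e | canonical i e
  ... | true | _ = []
  ... | false | true = [] ∷ []
  ... | false | false = []

  ∈-printed-from : ∀ {X} i e d → X L.∈ printed-from i e d → Σ ℕ λ e' → e ≤ e' × e' < e + d × Prints i e' × X ≡ fundamental (Bi i) e'
  ∈-printed-from i e (suc d) h with ∈-++⁻ (printed-at i e) h
  ... | inj₁ h1 = e , ≤-refl , m<m+n e (s≤s z≤n) , ∈-printed-at i e h1
  ... | inj₂ h2 with ∈-printed-from i (suc e) d h2
  ...   | e' , le , lt , g , eq = e' , ≤-trans (n≤1+n e) le , subst (e' <_) (sym (+-suc e d)) lt , g , eq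

  printed-from-∈ : ∀ i e d e' → e ≤ e' → e' < e + d → Prints i e' → fundamental (Bi i) e' L.∈ printed-from i e d
  printed-from-∈ i e zero e' le lt g = ⊥-elim (<-irrefl refl (<-≤-trans lt (≤-trans (≤-reflexive (+-identityʳ e)) le)))
  printed-from-∈ i e (suc d) e' le lt g with e ≟ e'
  ... | yes refl = ∈-++⁺ˡ (printed-at-∈ i e g)
    where open import Data.Nat using (_≟_)
  ... | no ne = ∈-++⁺ʳ (printed-at i e) (printed-from-∈ i (suc e) d e' (≤∧≢⇒< le ne) (subst (e' <_) (+-suc e d) lt) g)
    where open import Data.Nat using (_≟_)

  ∈-printed-bases : ∀ {X} i d → X L.∈ printed-bases i d → Σ ℕ λ i' → Σ ℕ λ e' → i ≤ i' × i' < i + d × e' < n × Prints i' e' × X ≡ fundamental (Bi i') e'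
  ∈-printed-bases i (suc d) h with ∈-++⁻ (printed-from i 0 n) h
  ... | inj₁ h1 with ∈-printed-from i 0 n h1
  ...   | e' , _ , lt , g , eq = i , e' , ≤-refl , m<m+n i (s≤s z≤n) , lt , g , eq
  ∈-printed-bases i (suc d) h | inj₂ h2 with ∈-printed-bases (suc i) d h2
  ...   | i' , e' , le , lt , el' , g , eq = i' , e' , ≤-trans (n≤1+n i) le , subst (i' <_) (sym (+-suc i d)) lt , el' , g , eq

  printed-bases-∈ : ∀ i d i' e' → i ≤ i' → i' < i + d → e' < n → Prints i' e' → fundamental (Bi i') e' L.∈ printed-bases i d
  printed-bases-∈ i zero i' e' le lt el' g = ⊥-elim (<-irrefl refl (<-≤-trans lt (≤-trans (≤-reflexive (+-identityʳ i)) le)))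
  printed-bases-∈ i (suc d) i' e' le lt el' g with i ≟ i'
  ... | yes refl = ∈-++⁺ˡ (printed-from-∈ i 0 n e' z≤n el' g)
    where open import Data.Nat using (_≟_)
  ... | no ne = ∈-++⁺ʳ (printed-from i 0 n) (printed-bases-∈ (suc i) d i' e' (≤∧≢⇒< le ne) (subst (i' <_) (+-suc i d) lt) el' g)
    where open import Data.Nat using (_≟_)

  at-false-∉ : ∀ {V : Subset n} {x} → at V (toℕ x) ≡ false → x FS.∉ V
  at-false-∉ h xV with trans (sym h) (∈⇒at xV)
  ... | ()

  ∉-at-false : ∀ (V : Subset n) x → x FS.∉ V → at V (toℕ x) ≡ false
  ∉-at-false V x h with at V (toℕ x) in eq
  ... | false = refl
  ... | true = ⊥-elim (h (at⇒∈ eq))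

  fundamental-injective : ∀ i e e' → e < n → (e'l : e' < n) → ¬ (e ≡ e') → at (Bi i) e' ≡ false → ¬ (fundamental (Bi i) e ≡ fundamental (Bi i) e')
  fundamental-injective i e e' eL e'l ne hb eq with Equivalence.to (fundamental-isFundamental (Bi i) e eL (fromℕ< e'l)) (subst (fromℕ< e'l FS.∈_) (sym eq) (Equivalence.from (fundamental-isFundamental (Bi i) e' e'l (fromℕ< e'l)) (inj₁ refl)))
  ... | inj₁ h = ne (sym (trans (sym (toℕ-fromℕ< e'l)) (trans (cong toℕ h) (toℕ-fromℕ< eL))))
  ... | inj₂ (h , _) = at-false-∉ (trans (cong (at (Bi i)) (toℕ-fromℕ< e'l)) hb) h

  fundamental-outside : ∀ i e (eL : e < n) x (xl : x < n) → at (fundamental (Bi i) e) x ≡ true → at (Bi i) x ≡ false → x ≡ e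
  fundamental-outside i e eL x xl hS hB with Equivalence.to (fundamental-isFundamental (Bi i) e eL (fromℕ< xl)) (at⇒∈ (trans (cong (at (fundamental (Bi i) e)) (toℕ-fromℕ< xl)) hS))
  ... | inj₁ h = trans (sym (toℕ-fromℕ< xl)) (trans (cong toℕ h) (toℕ-fromℕ< eL))
  ... | inj₂ (h , _) = ⊥-elim (at-false-∉ (trans (cong (at (Bi i)) (toℕ-fromℕ< xl)) hB) h)

  canonical-distinct : ∀ i i' e e' → i < i' → i' < m → e < n → canonical i' e' ≡ true → ¬ (fundamental (Bi i) e ≡ fundamental (Bi i') e')
  canonical-distinct i i' e e' ii' i'm eL hc eq with two-outside-sound (fundamental (Bi i') e') (Bi i) (proj₂ (canonical-from-sound (fundamental (Bi i') e') i' 0 bases true z≤n i'm hc) i ii')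
  ... | x , y , xy , yn , px , py = <-irrefl (trans (fundamental-outside i e eL x (<-trans xy yn) (subst (λ S → at S x ≡ true) (sym eq) (proj₁ (∧≡true⁻ _ _ px))) (notT (proj₂ (∧≡true⁻ _ _ px))))
                                                    (sym (fundamental-outside i e eL y yn (subst (λ S → at S y ≡ true) (sym eq) (proj₁ (∧≡true⁻ _ _ py))) (notT (proj₂ (∧≡true⁻ _ _ py)))))) xy
    where
    notT : ∀ {b} → not b ≡ true → b ≡ false
    notT {false} _ = refl

  printed-from-unique : ∀ i e d → e + d ≤ n → Unique (printed-from i e d)
  printed-from-unique i e zero le = []
  printed-from-unique i e (suc d) le = UP.++⁺ (printed-at-unique i e) (printed-from-unique i (suc e) d (subst (_≤ n) (+-suc e d) le)) disj
    where
    disj : ∀ {v} → ¬ (v L.∈ printed-at i e × v L.∈ printed-from i (suc e) d)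
    disj (h1 , h2) with ∈-printed-at i e h1 | ∈-printed-from i (suc e) d h2
    ... | (ga , gb) , eq1 | e' , le' , lt' , (ga' , gb') , eq2 =
      fundamental-injective i e e' (<-≤-trans (m<m+n e (s≤s z≤n)) le) (<-≤-trans lt' (subst (_≤ n) (+-suc e d) le)) (λ ee → <-irrefl ee le') ga' (trans (sym eq1) eq2)

  printed-bases-unique : ∀ i d → i + d ≤ m → Unique (printed-bases i d)
  printed-bases-unique i zero le = []
  printed-bases-unique i (suc d) le = UP.++⁺ (printed-from-unique i 0 n ≤-refl) (printed-bases-unique (suc i) d (subst (_≤ m) (+-suc i d) le)) disj
    where
    disj : ∀ {v} → ¬ (v L.∈ printed-from i 0 n × v L.∈ printed-bases (suc i) d)
    disj (h1 , h2) with ∈-printed-from i 0 n h1 | ∈-printed-bases (suc i) d h2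
    ... | e , _ , lt , g , eq1 | i' , e' , le' , lt' , eL' , (ga' , gb') , eq2 =
      canonical-distinct i i' e e' le' (<-≤-trans lt' (subst (_≤ m) (+-suc i d) le)) lt gb' (trans (sym eq1) eq2)

  printed⇒circuit : ∀ X → X L.∈ printed-bases 0 m → IsCircuit M X
  printed⇒circuit X h with ∈-printed-bases 0 m h
  ... | i , e , _ , im , eL , (ga , gb) , eq =
    subst (IsCircuit M) (sym eq) (fundamental-isCircuit M (Bi-isBase i im) (at-false-∉ (trans (cong (at (Bi i)) (toℕ-fromℕ< eL)) ga)) (fundamental-isFundamental (Bi i) e eL))

  index-of : ∀ {X} (Cs : List (Subset n)) → X L.∈ Cs → Σ ℕ λ j → j < length Cs × nth Cs j ≡ X
  index-of (B ∷ Cs) (here refl) = 0 , s≤s z≤n , refl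
  index-of (B ∷ Cs) (there h) with index-of Cs h
  ... | j , lt , eq = suc j , s≤s lt , eq

  OutsideAtColumn-intro : ∀ S (B : Subset n) x → x FS.∈ S → x FS.∉ B → OutsideAtColumn S B (toℕ x)
  OutsideAtColumn-intro S B x xS xB = ∧≡true⁺ _ _ (∈⇒at xS) (cong not (∉-at-false B x xB))

  two-outside-intro : ∀ S B x y → x FS.∈ S → x FS.∉ B → y FS.∈ S → y FS.∉ B → ¬ (x ≡ y) → two-outside S B ≡ true
  two-outside-intro S B x y xS xB yS yB ne with <-cmp (toℕ x) (toℕ y)
  ... | tri< lt _ _ = two-outside-complete S B (toℕ x) (toℕ y) lt (toℕ<n y) (OutsideAtColumn-intro S B x xS xB) (OutsideAtColumn-intro S B y yS yB)
  ... | tri≈ _ eq _ = ⊥-elim (ne (toℕ-injective eq))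
  ... | tri> _ _ gt = two-outside-complete S B (toℕ y) (toℕ x) gt (toℕ<n x) (OutsideAtColumn-intro S B y yS yB) (OutsideAtColumn-intro S B x xS xB)

  two-outside-elim : ∀ S (B : Subset n) → two-outside S B ≡ true → Σ (Fin n) λ x → Σ (Fin n) λ y → ¬ (x ≡ y) × x FS.∈ S × x FS.∉ B × y FS.∈ S × y FS.∉ B
  two-outside-elim S B h with two-outside-sound S B h
  ... | x , y , xy , yn , px , py = fromℕ< (<-trans xy yn) , fromℕ< yn ,
        (λ e → <-irrefl (trans (sym (toℕ-fromℕ< (<-trans xy yn))) (trans (cong toℕ e) (toℕ-fromℕ< yn))) xy) ,
        at⇒∈ (trans (cong (at S) (toℕ-fromℕ< _)) (proj₁ (∧≡true⁻ _ _ px))) ,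
        at-false-∉ (trans (cong (at B) (toℕ-fromℕ< _)) (notT (proj₂ (∧≡true⁻ _ _ px)))) ,
        at⇒∈ (trans (cong (at S) (toℕ-fromℕ< _)) (proj₁ (∧≡true⁻ _ _ py))) ,
        at-false-∉ (trans (cong (at B) (toℕ-fromℕ< _)) (notT (proj₂ (∧≡true⁻ _ _ py))))
    where
    notT : ∀ {b} → not b ≡ true → b ≡ false
    notT {false} _ = refl

  least-false : ∀ (p : ℕ → Bool) j → p j ≡ false → Σ ℕ λ i → i ≤ j × p i ≡ false × (∀ d → d < i → p d ≡ true)
  least-false p zero p0 = 0 , z≤n , p0 , λ d ()
  least-false p (suc j) pj with p 0 in p0
  ... | false = 0 , z≤n , p0 , λ d ()
  ... | true with least-false (λ d → p (suc d)) j pj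
  ...   | i , i≤j , pi , below = suc i , s≤s i≤j , pi , λ { zero _ → p0 ; (suc d) (s≤s d<i) → below d d<i }

  -- Removing one element e from a circuit C leaves an independent set, contained in some listed basis.
  circuit-near-listed : ∀ {C} → IsCircuit M C → Σ ℕ λ j → j < m × two-outside C (Bi j) ≡ false
  circuit-near-listed {C} (C-dep , C-min) with any? (_∈? C)
  ... | no C-empty = ⊥-elim (C-dep (B0 , listed⇒base (here refl) , λ {x} x∈C → ⊥-elim (C-empty (x , x∈C))))
  ... | yes (e , e∈C) with C-min (C FS.- e) (x∈p⇒p-x⊂p e∈C)
  ...   | B , B-base , C-e⊆B with index-of bases (base⇒listed B-base)
  ...     | j , j<m , Bj≡B = j , j<m , not-two
    where
    only-e : ∀ z → z FS.∈ C → z FS.∉ Bi j → z ≡ e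
    only-e z z∈C z∉Bj with z ≟F e
    ... | yes z≡e = z≡e
    ... | no z≢e = ⊥-elim (z∉Bj (subst (z FS.∈_) (sym Bj≡B) (C-e⊆B (x∈p∧x≢y⇒x∈p-y z∈C z≢e))))
    not-two : two-outside C (Bi j) ≡ false
    not-two with two-outside C (Bi j) in two?
    ... | false = refl
    ... | true with two-outside-elim C (Bi j) two?
    ...   | x , y , x≢y , x∈C , x∉Bj , y∈C , y∉Bj = ⊥-elim (x≢y (trans (only-e x x∈C x∉Bj) (sym (only-e y y∈C y∉Bj))))

  single-outside : ∀ {C B} → IsCircuit M C → IsBase B → two-outside C B ≡ false →
                   Σ (Fin n) λ e → e FS.∈ C × e FS.∉ B × (∀ {x} → x FS.∈ C → ¬ (x ≡ e) → x FS.∈ B)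
  single-outside {C} {B} (C-dep , _) B-base not-two with any? (λ x → (x ∈? C) ×-dec ¬? (x ∈? B))
  ... | no none = ⊥-elim (C-dep (B , B-base , λ {x} x∈C → inside x x∈C))
    where
    inside : ∀ x → x FS.∈ C → x FS.∈ B
    inside x x∈C with x ∈? B
    ... | yes x∈B = x∈B
    ... | no x∉B = ⊥-elim (none (x , x∈C , x∉B))
  ... | yes (e , e∈C , e∉B) = e , e∈C , e∉B , C-e⊆B
    where
    C-e⊆B : ∀ {x} → x FS.∈ C → ¬ (x ≡ e) → x FS.∈ B
    C-e⊆B {x} x∈C x≢e with x ∈? B
    ... | yes x∈B = x∈B
    ... | no x∉B with trans (sym (two-outside-intro C B x e x∈C x∉B e∈C e∉B x≢e)) not-two
    ...   | ()

  circuit⇒printed : ∀ C → IsCircuit M C → C L.∈ printed-bases 0 m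
  circuit⇒printed C C-circ with circuit-near-listed C-circ
  ... | j , j<m , not-twoⱼ with least-false (λ d → two-outside C (Bi d)) j not-twoⱼ
  ...   | i , i≤j , not-twoᵢ , two-before with single-outside C-circ (Bi-isBase i (≤-<-trans i≤j j<m)) not-twoᵢ
  ...     | e , e∈C , e∉Bi , C-e⊆Bi = subst (L._∈ printed-bases 0 m) (sym C≡) (printed-bases-∈ 0 m i (toℕ e) z≤n i<m (toℕ<n e) prints)
    where
    i<m : i < m
    i<m = ≤-<-trans i≤j j<m
    fund : IsFundamentalCircuit M (Bi i) e (fundamental (Bi i) (toℕ e))
    fund = subst (λ x → IsFundamentalCircuit M (Bi i) x (fundamental (Bi i) (toℕ e))) (fromℕ<-toℕ e (toℕ<n e))
                 (fundamental-isFundamental (Bi i) (toℕ e) (toℕ<n e))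
    C≡ : C ≡ fundamental (Bi i) (toℕ e)
    C≡ = circuit≡fundamental M C-circ e∈C (Bi-isBase i i<m) C-e⊆Bi fund
    prints : Prints i (toℕ e)
    prints = ∉-at-false (Bi i) e e∉Bi ,
             canonical-from-complete (fundamental (Bi i) (toℕ e)) i 0 bases true z≤n i<m refl
               (λ d d<i → subst (λ S → two-outside S (nth bases d) ≡ true) C≡ (two-before d d<i))

module TimeBound where

  open import Data.Nat using (ℕ; suc; _+_; _*_; _^_; _≤_; s≤s; z≤n)
  open import Data.Nat.Properties
  open import Relation.Binary.PropositionalEquality using (_≡_; subst; sym)
  open import Data.Nat.Tactic.RingSolver using (solve-∀)

  round-cost : ℕ → ℕ
  round-cost n = n * (7 * n + 9) + 4 * n + 5

  1≤⇒≤square : ∀ {a} → 1 ≤ a → a ≤ a * a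
  1≤⇒≤square {a} 1≤a = subst (_≤ a * a) (*-identityʳ a) (*-monoʳ-≤ a 1≤a)

  -- With L = m (n + 1): a round costs at most 13 (n + 1)², and a pass at most 2 L² + 2 ≤ 4 L² steps.
  steps-bound : ∀ m n j → 1 ≤ m → j ≤ (m * round-cost n) * (2 * (m * suc n + m * (n * suc n)) + 2) →
                2 * (m * suc n) + 2 + (j + m * suc n) ≤ 100 * (m * suc n) ^ 4 + 100
  steps-bound m n j 1≤m j≤ = ≤-trans total (subst (λ x → total-bound ≤ 100 * x + 100) (sym (power4 L)) final)
    where
    N = suc n
    L = m * N
    L⁴ = (L * L) * (L * L)
    1≤L : 1 ≤ L
    1≤L = *-mono-≤ 1≤m (s≤s z≤n)
    L≤L⁴ : L ≤ L⁴
    L≤L⁴ = ≤-trans (1≤⇒≤square 1≤L) (*-mono-≤ (1≤⇒≤square 1≤L) (1≤⇒≤square 1≤L))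
    mN²≤L² : m * (N * N) ≤ L * L
    mN²≤L² = subst (m * (N * N) ≤_) (sym (eq m N)) (*-monoˡ-≤ (N * N) (1≤⇒≤square 1≤m))
      where
      eq : ∀ m N → (m * N) * (m * N) ≡ (m * m) * (N * N)
      eq = solve-∀
    round≤ : round-cost n ≤ 13 * (N * N)
    round≤ = subst (round-cost n ≤_) (sym (eq n)) (m≤m+n (round-cost n) _)
      where
      eq : ∀ n → 13 * (suc n * suc n) ≡ (n * (7 * n + 9) + 4 * n + 5) + (6 * (n * n) + 13 * n + 8)
      eq = solve-∀
    P = m * (N * N)
    P≤L⁴ : P ≤ L⁴
    P≤L⁴ = ≤-trans mN²≤L² (1≤⇒≤square (*-mono-≤ 1≤L 1≤L))
    j≤P : j ≤ 26 * (P * P) + 26 * P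
    j≤P = ≤-trans j≤ (≤-trans (*-mono-≤ (*-monoʳ-≤ m round≤) (≤-reflexive (pass-eq m n))) (≤-reflexive (eq m N)))
      where
      pass-eq : ∀ m n → 2 * (m * suc n + m * (n * suc n)) + 2 ≡ 2 * (m * (suc n * suc n)) + 2
      pass-eq = solve-∀
      eq : ∀ m N → (m * (13 * (N * N))) * (2 * (m * (N * N)) + 2) ≡ 26 * ((m * (N * N)) * (m * (N * N))) + 26 * (m * (N * N))
      eq = solve-∀
    j≤L⁴ : j ≤ 26 * L⁴ + 26 * L⁴
    j≤L⁴ = ≤-trans j≤P (+-mono-≤ (*-monoʳ-≤ 26 (*-mono-≤ mN²≤L² mN²≤L²)) (*-monoʳ-≤ 26 P≤L⁴))
    total-bound = 2 * L⁴ + 2 + ((26 * L⁴ + 26 * L⁴) + L⁴)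
    total : 2 * L + 2 + (j + L) ≤ total-bound
    total = +-mono-≤ (+-monoˡ-≤ 2 (*-monoʳ-≤ 2 L≤L⁴)) (+-mono-≤ j≤L⁴ L≤L⁴)
    final : total-bound ≤ 100 * L⁴ + 100
    final = subst (_≤ 100 * L⁴ + 100) (sym (eq L⁴)) (+-mono-≤ (*-monoˡ-≤ L⁴ (m≤m+n 55 45)) (m≤m+n 2 98))
      where
      eq : ∀ x → 2 * x + 2 + ((26 * x + 26 * x) + x) ≡ 55 * x + 2
      eq = solve-∀
    power4 : ∀ x → x ^ 4 ≡ (x * x) * (x * x)
    power4 = expand
      where
      expand : ∀ x → x * (x * (x * (x * 1))) ≡ (x * x) * (x * x)
      expand = solve-∀

module Assembly (n : ℕ) (B0 : Vec Bool n) (Bs : List (Subset n)) (M : Matroid n)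
                (enum : Enumerates (Matroid.IsBase M) (B0 ∷ Bs)) where

  open import Data.Nat.Properties
  open import Data.List using (_ʳ++_)
  open import Data.List.Properties using (map-++; ++-assoc; length-++; length-map; ++-identityʳ)
  open import Data.List.Relation.Unary.All using ([])
  open import Data.Product using (_,_; Σ)
  open import Function.Bundles using (mk⇔)
  open import Relation.Binary.PropositionalEquality
  open ≡-Reasoning
  open Program
  open Loops n B0 Bs
  open Correctness n B0 Bs M enum using (printed-bases-unique; printed⇒circuit; circuit⇒printed)

  circuits : List (Subset n)
  circuits = printed-bases 0 m

  circuits-enumerated : Enumerates (IsCircuit M) circuits
  circuits-enumerated = printed-bases-unique 0 m ≤-refl , λ X → mk⇔ (printed⇒circuit X) (circuit⇒printed X)

  length-printed-bases : ∀ i d → length (printed-bases i d) ≤ d * n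
  length-printed-bases i zero = z≤n
  length-printed-bases i (suc d) rewrite length-++ (printed-from i 0 n) {printed-bases (suc i) d} =
    +-mono-≤ (length-printed-from 0 n) (length-printed-bases (suc i) d)
    where
    length-printed-from : ∀ e d → length (printed-from i e d) ≤ d
    length-printed-from e zero = z≤n
    length-printed-from e (suc d) rewrite length-++ (printed-at i e) {printed-from i (suc e) d} with at (Bi i) e | canonical i e
    ... | true | _ = m≤n⇒m≤1+n (length-printed-from (suc e) d)
    ... | false | true = s≤s (length-printed-from (suc e) d)
    ... | false | false = m≤n⇒m≤1+n (length-printed-from (suc e) d)

  printed≤Ω : length (setsBits circuits) ≤ Ω
  printed≤Ω rewrite length-setsBits circuits | sym (*-assoc m n (suc n)) = *-monoˡ-≤ (suc n) (length-printed-bases 0 m)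

  length-input : length (encodeSets {TM.extra machine} bases) ≡ m * suc n
  length-input = begin
    length (encodeSets bases)     ≡⟨ cong length (encs-setsBits bases) ⟨
    length (encs input-cells)     ≡⟨ length-map encCell input-cells ⟩
    length input-cells            ≡⟨ length-map raw (setsBits bases) ⟩
    length (setsBits bases)       ≡⟨ length-setsBits bases ⟩
    m * suc n                     ∎

  tracked : ∀ σ → Σ (List Track) λ ts → blocks σ 0 bases ≡ map trk ts
  tracked σ = tracks-from 0 bases
    where
    block-tracks : ∀ I c {l} (B : Vec Bool l) → Σ (List Track) λ ts → block σ I c B ≡ map trk ts
    block-tracks I c [] = _ , refl
    block-tracks I c (b ∷ B) with block-tracks I (suc c) B
    ... | ts , eq = _ , cong (trk (data-track σ I c b) ∷_) eq
    tracks-from : ∀ j Cs → Σ (List Track) λ ts → blocks σ j Cs ≡ map trk ts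
    tracks-from j [] = [] , refl
    tracks-from j (B ∷ Cs) with block-tracks (j ≡ᵇ i σ) 0 B | tracks-from (suc j) Cs
    ... | ts₁ , eq₁ | ts₂ , eq₂ = ts₁ ++ ts₂ , trans (cong₂ _++_ eq₁ eq₂) (sym (map-++ trk ts₁ ts₂))

  input-loaded : Loaded (initial machine (encodeSets bases)) (entering cInit) input-cells
  input-loaded = [] , [] , [] , [] , trans (initial-conf _)
    (cong (conf (entering cInit) []) (trans (sym (encs-setsBits bases)) (sym (++-identityʳ (encs input-cells)))))

  initialisation : Σ Conf λ b → Shows (entering cResetKB) σ₀ b × Steps (2 * (m * suc n) + 2) (initial machine (encodeSets bases)) b
  initialisation with pass-steps cInit input-cells _ input-loaded
  ... | b , b-loaded , steps = b , subst (Loaded b (entering cResetKB)) pass-output-init b-loaded ,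
                               Steps-cost (cong (λ l → 2 * l + 2) (trans (length-map raw (setsBits bases)) (length-setsBits bases))) steps

  program : BasisLoop σ₀ (length Bs)
  program = basis-loop (length Bs) σ₀ refl

  σ-final : Store
  σ-final = BasisLoop.σ' program

  execution : ∀ a → Shows (entering cResetKB) σ₀ a → Σ Conf λ b → Shows seeking σ-final b × StepsWithin (m * basis-cost * K) a b
  execution = Run.simulate (BasisLoop.runs program) (subst (λ o → length o ≤ Ω) (sym (BasisLoop.printed program)) printed≤Ω)

  finish : ∀ {σ a} → out σ ≡ setsBits circuits → Shows seeking σ a →
           Σ Conf λ b → Steps (m * suc n) a b × Halted machine b × output machine b ≡ encodeSets circuits
  finish {σ} out≡ (ls , bs , _ , bs-blank , refl) with tracked σ
  ... | ts , tracks≡ = conf seeking (encs (map trk ts) ʳ++ ls) printed-tape ,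
                       Steps-cost length-ts (subst (λ a → Steps (length ts) a (conf seeking (encs (map trk ts) ʳ++ ls) printed-tape))
                                                   (sym tape≡) (seek ts ls printed-tape)) ,
                       seeking-halts (encs (map trk ts) ʳ++ ls) (setsBits circuits) bs bs-blank ,
                       trans (output-raw seeking (encs (map trk ts) ʳ++ ls) (setsBits circuits) bs bs-blank) (encs-setsBits circuits)
    where
    printed-tape = encs (map raw (setsBits circuits)) ++ bs
    length-ts : length ts ≡ m * suc n
    length-ts = trans (sym (length-map trk ts)) (trans (cong length (sym tracks≡)) (length-blocks σ 0 bases))
    tape≡ : conf seeking ls (encs (render σ) ++ bs) ≡ conf seeking ls (encs (map trk ts) ++ printed-tape)
    tape≡ = cong (conf seeking ls) (begin
      encs (blocks σ 0 bases ++ map raw (out σ)) ++ bs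
        ≡⟨ cong₂ (λ xs o → encs (xs ++ map raw o) ++ bs) tracks≡ out≡ ⟩
      encs (map trk ts ++ map raw (setsBits circuits)) ++ bs
        ≡⟨ cong (_++ bs) (map-++ encCell (map trk ts) _) ⟩
      (encs (map trk ts) ++ encs (map raw (setsBits circuits))) ++ bs
        ≡⟨ ++-assoc (encs (map trk ts)) _ bs ⟩
      encs (map trk ts) ++ encs (map raw (setsBits circuits)) ++ bs ∎)

  steps-bound : ∀ j → j ≤ m * basis-cost * K →
                2 * (m * suc n) + 2 + (j + m * suc n) ≤ 100 * length (encodeSets {TM.extra machine} bases) ^ 4 + 100
  steps-bound j j≤ = subst (λ L → 2 * (m * suc n) + 2 + (j + m * suc n) ≤ 100 * L ^ 4 + 100) (sym length-input) (TimeBound.steps-bound m n j (s≤s z≤n) j≤)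

  halts : HaltsWithin machine (100 * length (encodeSets {TM.extra machine} bases) ^ 4 + 100) (encodeSets bases) (encodeSets circuits)
  halts =
    let (b₁ , b₁-shows , init-steps) = initialisation
        (b₂ , b₂-shows , j , j≤ , run-steps) = execution b₁ b₁-shows
        (b₃ , seek-steps , halted , output≡) = finish (BasisLoop.printed program) b₂-shows
    in halts-within (steps-bound j j≤) (init-steps ▷ run-steps ▷ seek-steps) halted output≡

lemma4 : ∃[ T ] ∃[ c ] ∃[ d ] (∀ (n : ℕ) (M : Matroid n) (bases : List (Subset n)) →
           Enumerates (Matroid.IsBase M) bases →
           ∃[ circuits ] (Enumerates (IsCircuit M) circuits ×
             HaltsWithin T (c * length (encodeSets {TM.extra T} bases) ^ d + c)
               (encodeSets bases) (encodeSets circuits)))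
lemma4 = Program.machine , 100 , 4 , λ where
  n M [] enum → ⊥-elim (∉[] (Equivalence.from (proj₂ enum _) (proj₂ (Matroid.base-nonempty M))))
  n M (B0 ∷ Bs) enum → Assembly.circuits n B0 Bs M enum , Assembly.circuits-enumerated n B0 Bs M enum , Assembly.halts n B0 Bs M enum
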